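{- Let $s\ge2$, $k\ge0$, $1\le t\le s-1$, $1\le r\le t$, and $n,p\ge0$ be integers. The number of words $\pi\in[sk+t]^n$ with $\overleftarrow{\mathrm{des}}_{R_r}(\pi)=p$, which also equals the number of words $\pi\in[sk+t]^n$ with $\overleftarrow{\mathrm{ris}}_{R_{t+1-r}}(\pi)=p$, is $$\sum_{m=0}^n\sum_{j=0}^m\sum_{i_1=0}^{m-j}\sum_{i_2=0}^{j}(-1)^{n+p+j}s^{m-i_1-i_2}(s-t+r-1)^{i_1}(r-1)^{i_2}\binom{m}{j}\binom{m-j}{i_1}\binom{j}{i_2}\binom{kj+j}{n-i_1-i_2}\binom{n-m}{p}.$$
   Context: $[N]=\{1,\ldots,N\}$ and $[N]^n$ is the set of words of length $n$ over $[N]$. For an integer $c$, $R_c=\{x\in\mathbb{N}: x\equiv c \pmod s\}$. For a word $\pi=\pi_1\cdots\pi_n$ and $X\subseteq\mathbb{N}$, $\overleftarrow{\mathrm{des}}_X(\pi)=|\{i:\pi_i>\pi_{i+1},\ \pi_i\in X\}|$ and $\overleftarrow{\mathrm{ris}}_X(\pi)=|\{i:\pi_i<\pi_{i+1},\ \pi_i\in X\}|$. Conventions: $\binom{a}{b}=0$ if $b<0$ or $b>a$ (for $a\ge0$), and $0^0=1$. -}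

module Defs where

open import Data.Nat using (ℕ; zero; suc; _+_; _*_; _∸_; _<ᵇ_; _%_; NonZero)
open import Data.Nat.Combinatorics using (_C_)
open import Data.Bool using (Bool; true; false; _∧_; if_then_else_)
open import Data.List using (List; []; _∷_; map; concatMap; length; filterᵇ)
open import Data.Integer as ℤ using (ℤ; +_; -[1+_])
import Data.Nat as ℕ

letters : ℕ → List ℕ
letters zero = []
letters (suc N) = go 1 (suc N)
  where
  go : ℕ → ℕ → List ℕ
  go a zero = []
  go a (suc k) = a ∷ go (suc a) k

words : ℕ → ℕ → List (List ℕ)
words N zero = [] ∷ []
words N (suc n) = concatMap (λ a → map (a ∷_) (words N n)) (letters N)

inR : (s : ℕ) .{{_ : NonZero s}} → ℕ → ℕ → Bool
inR s c x = (x % s) ℕ.≡ᵇ (c % s)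

-- left descents / left rises restricted to R_c:
-- number of i with π_i > π_{i+1} (resp. π_i < π_{i+1}) and π_i ∈ R_c
desR : (s : ℕ) .{{_ : NonZero s}} → ℕ → List ℕ → ℕ
desR s c [] = 0
desR s c (a ∷ []) = 0
desR s c (a ∷ b ∷ w) =
  (if (b <ᵇ a) ∧ inR s c a then 1 else 0) + desR s c (b ∷ w)

risR : (s : ℕ) .{{_ : NonZero s}} → ℕ → List ℕ → ℕ
risR s c [] = 0
risR s c (a ∷ []) = 0
risR s c (a ∷ b ∷ w) =
  (if (a <ᵇ b) ∧ inR s c a then 1 else 0) + risR s c (b ∷ w)

countWords : ℕ → ℕ → (List ℕ → ℕ) → ℕ → ℕ
countWords N n f p = length (filterᵇ (λ π → f π ℕ.≡ᵇ p) (words N n))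

Σℤ : ℕ → (ℕ → ℤ) → ℤ
Σℤ zero f = f 0
Σℤ (suc n) f = Σℤ n f ℤ.+ f (suc n)

-- binomial coefficient with integer lower index: 0 if b < 0 (and a C b = 0 if b > a)
binomℤ : ℕ → ℤ → ℕ
binomℤ a (+ b) = a C b
binomℤ a -[1+ b ] = 0

sign : ℕ → ℤ
sign e = (ℤ.- (+ 1)) ℤ.^ e

formula : (s k t r n p : ℕ) → ℤ
formula s k t r n p =
  Σℤ n λ m → Σℤ m λ j → Σℤ (m ∸ j) λ i₁ → Σℤ j λ i₂ →
    sign (n + p + j) ℤ.*
    + ( (s ℕ.^ (m ∸ i₁ ∸ i₂)) * (((s ∸ t) + r ∸ 1) ℕ.^ i₁) * ((r ∸ 1) ℕ.^ i₂)
        * (m C j) * ((m ∸ j) C i₁) * (j C i₂)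
        * binomℤ (k * j + j) ((+ n) ℤ.- (+ (i₁ + i₂)))
        * ((n ∸ m) C p) )

-- Write a R b for "a > b and a ∈ R_r", so that des_{R_r}(π) counts the links π_i R π_{i+1} of π.
-- By binomial inversion, the number of words with exactly p links is Σ_i (-1)^(i+p) C(i,p) M_i,
-- where M_i = Σ_π C(links π, i) counts words with i of their links marked.  Cutting such a word at
-- its unmarked links leaves n - i maximal blocks, each a chain a₀ R a₁ R ⋯ R a_ℓ; hence
-- M_i = [z^n] B(z)^(n-i) for the generating function B of chains by their number of letters.
-- For R as above, prefix sums over the residue class R_r give B(z) = (bz + s)(1+z)^(k+1) - az - s
-- with a = s-t+r-1 and b = r-1, and expanding B^m twice by the binomial theorem yields the formula.
-- The complement x ↦ sk+t+1-x permutes the words and turns rises from R_(t+1-r) into descents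
-- from R_r, which gives the second count.

module Submission where

open import Defs
open import Data.Nat using (ℕ; _+_; _*_; _∸_; _≤_; _≥_; NonZero)
open import Data.Integer using (+_)
open import Data.Product using (_×_)
open import Relation.Binary.PropositionalEquality using (_≡_)

open import Algebra.Bundles using (CommutativeSemiring)
import Algebra.Construct.Pointwise as Pointwise
import Algebra.Structures.Biased as Biased
open import Data.Bool using (Bool; true; false; if_then_else_; _∧_; T)
open import Data.Bool.Properties using (⇔→≡)
open import Data.Fin using (toℕ)
open import Data.Integer as ℤ using (ℤ; 0ℤ; 1ℤ; -1ℤ; -_; _-_) renaming (_+_ to _+ℤ_; _*_ to _*ℤ_; _^_ to _^ℤ_)
import Data.Integer.Properties as ℤₚ
open import Data.Integer.Solver renaming (module +-*-Solver to ℤ-Solver)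
open import Data.List using (List; []; _∷_; _++_; _∷ʳ_; map; concatMap; length; filterᵇ; applyUpTo; applyDownFrom; reverse)
import Data.List.Properties as Listₚ
open import Data.List.Membership.Propositional using (_∈_; find)
open import Data.List.Membership.Propositional.Properties using (∈-concatMap⁻; ∈-map⁻; ∈-applyUpTo⁻)
open import Data.List.Relation.Unary.All using (All; []; _∷_)
open import Data.List.Relation.Unary.Any using (here; there)
open import Data.Nat as ℕ using (zero; suc; _<_; z≤n; s≤s; _≡ᵇ_; _<ᵇ_; _%_; _/_; _<?_; _≟_)
import Data.Nat.Properties as ℕₚ
open import Data.Nat.Combinatorics using (_C_; nCk+nC[k+1]≡[n+1]C[k+1]; nC1≡n; k>n⇒nCk≡0)
open import Data.Nat.DivMod using (m≡m%n+[m/n]*n; [m+kn]%n≡m%n; m<n⇒m%n≡m)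
open import Data.Nat.Solver renaming (module +-*-Solver to ℕ-Solver)
open import Data.Product using (_,_; proj₁; proj₂)
open import Data.Sum using (inj₁; inj₂)
open import Function using (_∘_; mk⇔)
open import Level using (0ℓ)
open import Relation.Nullary using (yes; no; contradiction)
open import Relation.Nullary.Decidable using (dec-true; dec-false)
open import Relation.Binary.PropositionalEquality
  using (refl; sym; trans; cong; cong₂; subst; _≗_; isEquivalence; module ≡-Reasoning)
open import Algebra.Properties.CommutativeSemigroup ℤₚ.+-commutativeSemigroup using (interchange)
open ≡-Reasoning

-- Finite sums

∑ : ℕ → (ℕ → ℤ) → ℤ
∑ zero    f = f 0
∑ (suc n) f = f 0 +ℤ ∑ n (f ∘ suc)

syntax ∑ n (λ i → e) = ∑[ i ≤ n ] e

∑-cong : ∀ n {f g : ℕ → ℤ} → (∀ i → i ≤ n → f i ≡ g i) → ∑ n f ≡ ∑ n g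
∑-cong zero    eq = eq 0 z≤n
∑-cong (suc n) eq = cong₂ _+ℤ_ (eq 0 z≤n) (∑-cong n (λ i i≤n → eq (suc i) (s≤s i≤n)))

∑-zero : ∀ n → ∑[ i ≤ n ] 0ℤ ≡ 0ℤ
∑-zero zero    = refl
∑-zero (suc n) = trans (ℤₚ.+-identityˡ _) (∑-zero n)

∑-+ : ∀ n (f g : ℕ → ℤ) → ∑[ i ≤ n ] (f i +ℤ g i) ≡ ∑ n f +ℤ ∑ n g
∑-+ zero    f g = refl
∑-+ (suc n) f g = trans (cong (f 0 +ℤ g 0 +ℤ_) (∑-+ n (f ∘ suc) (g ∘ suc)))
                        (interchange (f 0) (g 0) _ _)

*-distribˡ-∑ : ∀ n c (f : ℕ → ℤ) → c *ℤ ∑ n f ≡ ∑[ i ≤ n ] (c *ℤ f i)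
*-distribˡ-∑ zero    c f = refl
*-distribˡ-∑ (suc n) c f = trans (ℤₚ.*-distribˡ-+ c (f 0) _) (cong (c *ℤ f 0 +ℤ_) (*-distribˡ-∑ n c (f ∘ suc)))

*-distribʳ-∑ : ∀ n c (f : ℕ → ℤ) → ∑ n f *ℤ c ≡ ∑[ i ≤ n ] (f i *ℤ c)
*-distribʳ-∑ n c f = trans (ℤₚ.*-comm (∑ n f) c)
  (trans (*-distribˡ-∑ n c f) (∑-cong n (λ i _ → ℤₚ.*-comm c (f i))))

∑-last : ∀ n (f : ℕ → ℤ) → ∑ (suc n) f ≡ ∑ n f +ℤ f (suc n)
∑-last zero    f = refl
∑-last (suc n) f = trans (cong (f 0 +ℤ_) (∑-last n (f ∘ suc))) (sym (ℤₚ.+-assoc (f 0) _ _))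

Σℤ≡∑ : ∀ n f → Σℤ n f ≡ ∑ n f
Σℤ≡∑ zero    f = refl
Σℤ≡∑ (suc n) f = trans (cong (_+ℤ f (suc n)) (Σℤ≡∑ n f)) (sym (∑-last n f))

∑-reverse : ∀ n (f : ℕ → ℤ) → ∑ n f ≡ ∑[ i ≤ n ] f (n ∸ i)
∑-reverse zero    f = refl
∑-reverse (suc n) f = begin
  f 0 +ℤ ∑ n (f ∘ suc)                     ≡⟨ cong (f 0 +ℤ_) (∑-reverse n (f ∘ suc)) ⟩
  f 0 +ℤ ∑[ i ≤ n ] f (suc (n ∸ i))        ≡⟨ ℤₚ.+-comm (f 0) _ ⟩
  ∑[ i ≤ n ] f (suc (n ∸ i)) +ℤ f 0        ≡⟨ cong₂ _+ℤ_ (∑-cong n (λ i i≤n → cong f (sym (ℕₚ.+-∸-assoc 1 i≤n))))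
                                                          (cong f (sym (ℕₚ.n∸n≡0 n))) ⟩
  ∑[ i ≤ n ] f (suc n ∸ i) +ℤ f (n ∸ n)    ≡⟨ sym (∑-last n (λ i → f (suc n ∸ i))) ⟩
  ∑[ i ≤ suc n ] f (suc n ∸ i)             ∎

∑-comm : ∀ n m (F : ℕ → ℕ → ℤ) → ∑[ i ≤ n ] ∑[ j ≤ m ] F i j ≡ ∑[ j ≤ m ] ∑[ i ≤ n ] F i j
∑-comm zero    m F = refl
∑-comm (suc n) m F = trans (cong (∑ m (F 0) +ℤ_) (∑-comm n m (F ∘ suc))) (sym (∑-+ m (F 0) _))

∑-triangle : ∀ n (F : ℕ → ℕ → ℤ) →
  ∑[ v ≤ n ] ∑[ l ≤ v ] F l v ≡ ∑[ l ≤ n ] ∑[ u ≤ n ∸ l ] F l (l + u)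
∑-triangle zero    F = refl
∑-triangle (suc n) F = begin
  F 0 0 +ℤ ∑[ v ≤ n ] (F 0 (suc v) +ℤ ∑[ l ≤ v ] F (suc l) (suc v))
    ≡⟨ cong (F 0 0 +ℤ_) (∑-+ n _ _) ⟩
  F 0 0 +ℤ (∑[ v ≤ n ] F 0 (suc v) +ℤ ∑[ v ≤ n ] ∑[ l ≤ v ] F (suc l) (suc v))
    ≡⟨ sym (ℤₚ.+-assoc (F 0 0) _ _) ⟩
  ∑[ u ≤ suc n ] F 0 u +ℤ ∑[ v ≤ n ] ∑[ l ≤ v ] F (suc l) (suc v)
    ≡⟨ cong (∑ (suc n) (F 0) +ℤ_) (∑-triangle n (λ l v → F (suc l) (suc v))) ⟩
  ∑[ u ≤ suc n ] F 0 u +ℤ ∑[ l ≤ n ] ∑[ u ≤ n ∸ l ] F (suc l) (suc l + u) ∎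

∑ₗ : {A : Set} → (A → ℤ) → List A → ℤ
∑ₗ f []       = 0ℤ
∑ₗ f (x ∷ xs) = f x +ℤ ∑ₗ f xs

syntax ∑ₗ (λ x → e) xs = ∑[ x ← xs ] e

module _ {A : Set} where

  ∑ₗ-cong : ∀ (xs : List A) {f g : A → ℤ} → (∀ x → x ∈ xs → f x ≡ g x) → ∑ₗ f xs ≡ ∑ₗ g xs
  ∑ₗ-cong []       eq = refl
  ∑ₗ-cong (x ∷ xs) eq = cong₂ _+ℤ_ (eq x (here refl)) (∑ₗ-cong xs (λ y y∈xs → eq y (there y∈xs)))

  ∑ₗ-zero : ∀ (xs : List A) → ∑[ x ← xs ] 0ℤ ≡ 0ℤ
  ∑ₗ-zero []       = refl
  ∑ₗ-zero (x ∷ xs) = trans (ℤₚ.+-identityˡ _) (∑ₗ-zero xs)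

  ∑ₗ-++ : ∀ (f : A → ℤ) xs ys → ∑ₗ f (xs ++ ys) ≡ ∑ₗ f xs +ℤ ∑ₗ f ys
  ∑ₗ-++ f []       ys = sym (ℤₚ.+-identityˡ _)
  ∑ₗ-++ f (x ∷ xs) ys = trans (cong (f x +ℤ_) (∑ₗ-++ f xs ys)) (sym (ℤₚ.+-assoc (f x) _ _))

  ∑ₗ-+ : ∀ (f g : A → ℤ) xs → ∑[ x ← xs ] (f x +ℤ g x) ≡ ∑ₗ f xs +ℤ ∑ₗ g xs
  ∑ₗ-+ f g []       = refl
  ∑ₗ-+ f g (x ∷ xs) = trans (cong (f x +ℤ g x +ℤ_) (∑ₗ-+ f g xs)) (interchange (f x) (g x) _ _)

  *-distribˡ-∑ₗ : ∀ c (f : A → ℤ) xs → c *ℤ ∑ₗ f xs ≡ ∑[ x ← xs ] (c *ℤ f x)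
  *-distribˡ-∑ₗ c f []       = ℤₚ.*-zeroʳ c
  *-distribˡ-∑ₗ c f (x ∷ xs) = trans (ℤₚ.*-distribˡ-+ c (f x) _) (cong (c *ℤ f x +ℤ_) (*-distribˡ-∑ₗ c f xs))

  *-distribʳ-∑ₗ : ∀ c (f : A → ℤ) xs → ∑ₗ f xs *ℤ c ≡ ∑[ x ← xs ] (f x *ℤ c)
  *-distribʳ-∑ₗ c f []       = ℤₚ.*-zeroˡ c
  *-distribʳ-∑ₗ c f (x ∷ xs) = trans (ℤₚ.*-distribʳ-+ c (f x) _) (cong (f x *ℤ c +ℤ_) (*-distribʳ-∑ₗ c f xs))

  ∑ₗ-∑ : ∀ n (F : A → ℕ → ℤ) xs → ∑[ x ← xs ] ∑ n (F x) ≡ ∑[ i ≤ n ] ∑[ x ← xs ] F x i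
  ∑ₗ-∑ n F []       = sym (∑-zero n)
  ∑ₗ-∑ n F (x ∷ xs) = trans (cong (∑ n (F x) +ℤ_) (∑ₗ-∑ n F xs)) (sym (∑-+ n (F x) _))

  ∑ₗ-reverse : ∀ (f : A → ℤ) xs → ∑ₗ f (reverse xs) ≡ ∑ₗ f xs
  ∑ₗ-reverse f []       = refl
  ∑ₗ-reverse f (x ∷ xs) = begin
    ∑ₗ f (reverse (x ∷ xs))        ≡⟨ cong (∑ₗ f) (Listₚ.unfold-reverse x xs) ⟩
    ∑ₗ f (reverse xs ∷ʳ x)         ≡⟨ ∑ₗ-++ f (reverse xs) (x ∷ []) ⟩
    ∑ₗ f (reverse xs) +ℤ (f x +ℤ 0ℤ) ≡⟨ cong₂ _+ℤ_ (∑ₗ-reverse f xs) (ℤₚ.+-identityʳ (f x)) ⟩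
    ∑ₗ f xs +ℤ f x                 ≡⟨ ℤₚ.+-comm _ (f x) ⟩
    ∑ₗ f (x ∷ xs)                  ∎

∑ₗ-map : ∀ {A B : Set} (f : B → ℤ) (h : A → B) xs → ∑ₗ f (map h xs) ≡ ∑ₗ (f ∘ h) xs
∑ₗ-map f h []       = refl
∑ₗ-map f h (x ∷ xs) = cong (f (h x) +ℤ_) (∑ₗ-map f h xs)

∑ₗ-concatMap : ∀ {A B : Set} (f : B → ℤ) (h : A → List B) xs →
  ∑ₗ f (concatMap h xs) ≡ ∑[ x ← xs ] ∑ₗ f (h x)
∑ₗ-concatMap f h []       = refl
∑ₗ-concatMap f h (x ∷ xs) = trans (∑ₗ-++ f (h x) (concatMap h xs)) (cong (∑ₗ f (h x) +ℤ_) (∑ₗ-concatMap f h xs))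

-- Formal power series with integer coefficients

Series : Set
Series = ℕ → ℤ

infixl 6 _⊕_
infixl 7 _⊛_

_⊕_ : Series → Series → Series
(f ⊕ g) n = f n +ℤ g n

_⊛_ : Series → Series → Series
(f ⊛ g) n = ∑[ l ≤ n ] (f l *ℤ g (n ∸ l))

0ₛ : Series
0ₛ _ = 0ℤ

1ₛ : Series
1ₛ zero    = 1ℤ
1ₛ (suc _) = 0ℤ

⊛-cong : ∀ {f f′ g g′} → f ≗ f′ → g ≗ g′ → f ⊛ g ≗ f′ ⊛ g′
⊛-cong f≗f′ g≗g′ n = ∑-cong n (λ l _ → cong₂ _*ℤ_ (f≗f′ l) (g≗g′ (n ∸ l)))

⊛-congˡ : ∀ {f f′} g → f ≗ f′ → f ⊛ g ≗ f′ ⊛ g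
⊛-congˡ g f≗f′ = ⊛-cong {g = g} f≗f′ (λ _ → refl)

⊛-congʳ : ∀ f {g g′} → g ≗ g′ → f ⊛ g ≗ f ⊛ g′
⊛-congʳ f g≗g′ = ⊛-cong {f = f} (λ _ → refl) g≗g′

⊛-comm : ∀ f g → f ⊛ g ≗ g ⊛ f
⊛-comm f g n = begin
  ∑[ l ≤ n ] (f l *ℤ g (n ∸ l))               ≡⟨ ∑-reverse n _ ⟩
  ∑[ l ≤ n ] (f (n ∸ l) *ℤ g (n ∸ (n ∸ l)))   ≡⟨ ∑-cong n (λ l l≤n → trans (ℤₚ.*-comm (f (n ∸ l)) _)
                                                   (cong (λ i → g i *ℤ f (n ∸ l)) (ℕₚ.m∸[m∸n]≡n l≤n))) ⟩
  ∑[ l ≤ n ] (g l *ℤ f (n ∸ l))               ∎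

⊛-assoc : ∀ f g h → (f ⊛ g) ⊛ h ≗ f ⊛ (g ⊛ h)
⊛-assoc f g h n = begin
  ∑[ v ≤ n ] (∑[ l ≤ v ] (f l *ℤ g (v ∸ l)) *ℤ h (n ∸ v))
    ≡⟨ ∑-cong n (λ v _ → *-distribʳ-∑ v _ _) ⟩
  ∑[ v ≤ n ] ∑[ l ≤ v ] (f l *ℤ g (v ∸ l) *ℤ h (n ∸ v))
    ≡⟨ ∑-triangle n _ ⟩
  ∑[ l ≤ n ] ∑[ u ≤ n ∸ l ] (f l *ℤ g (l + u ∸ l) *ℤ h (n ∸ (l + u)))
    ≡⟨ ∑-cong n (λ l _ → ∑-cong (n ∸ l) (λ u _ → trans (ℤₚ.*-assoc (f l) _ _)
         (cong₂ (λ i j → f l *ℤ (g i *ℤ h j)) (ℕₚ.m+n∸m≡n l u) (sym (ℕₚ.∸-+-assoc n l u))))) ⟩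
  ∑[ l ≤ n ] ∑[ u ≤ n ∸ l ] (f l *ℤ (g u *ℤ h (n ∸ l ∸ u)))
    ≡⟨ ∑-cong n (λ l _ → sym (*-distribˡ-∑ (n ∸ l) (f l) _)) ⟩
  ∑[ l ≤ n ] (f l *ℤ ∑[ u ≤ n ∸ l ] (g u *ℤ h (n ∸ l ∸ u))) ∎

⊛-identityˡ : ∀ f → 1ₛ ⊛ f ≗ f
⊛-identityˡ f zero    = ℤₚ.*-identityˡ (f 0)
⊛-identityˡ f (suc n) = trans (cong₂ _+ℤ_ (ℤₚ.*-identityˡ (f (suc n))) (∑-zero n)) (ℤₚ.+-identityʳ _)

⊛-zeroˡ : ∀ f → 0ₛ ⊛ f ≗ 0ₛ
⊛-zeroˡ f n = ∑-zero n

⊛-distribʳ : ∀ f g h → (g ⊕ h) ⊛ f ≗ g ⊛ f ⊕ h ⊛ f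
⊛-distribʳ f g h n = trans (∑-cong n (λ l _ → ℤₚ.*-distribʳ-+ (f (n ∸ l)) (g l) (h l))) (∑-+ n _ _)

seriesSemiring : CommutativeSemiring 0ℓ 0ℓ
seriesSemiring = record
  { Carrier = Series ; _≈_ = _≗_ ; _+_ = _⊕_ ; _*_ = _⊛_ ; 0# = 0ₛ ; 1# = 1ₛ
  ; isCommutativeSemiring = Biased.isCommutativeSemiringˡ record
    { +-isCommutativeMonoid = Pointwise.isCommutativeMonoid ℕ ℤₚ.+-0-isCommutativeMonoid
    ; *-isCommutativeMonoid = Biased.isCommutativeMonoidˡ record
      { isSemigroup = record
        { isMagma = record { isEquivalence = Pointwise.isEquivalence ℕ isEquivalence ; ∙-cong = ⊛-cong }
        ; assoc   = ⊛-assoc }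
      ; identityˡ = ⊛-identityˡ
      ; comm      = ⊛-comm }
    ; distribʳ = ⊛-distribʳ
    ; zeroˡ    = ⊛-zeroˡ } }

open import Algebra.Properties.CommutativeSemiring.Exp seriesSemiring using (_^_; ^-congˡ; ^-distrib-*; ^-assocʳ)
import Algebra.Properties.CommutativeSemiring.Binomial seriesSemiring as Binomial
open import Algebra.Definitions.RawSemiring (CommutativeSemiring.rawSemiring seriesSemiring) using (sum) renaming (_×_ to _×ₛ_)

×ₛ-coefficient : ∀ c f q → (c ×ₛ f) q ≡ + c *ℤ f q
×ₛ-coefficient zero    f q = refl
×ₛ-coefficient (suc c) f q = begin
  f q +ℤ (c ×ₛ f) q        ≡⟨ cong (f q +ℤ_) (×ₛ-coefficient c f q) ⟩
  f q +ℤ + c *ℤ f q        ≡⟨ cong (_+ℤ + c *ℤ f q) (sym (ℤₚ.*-identityˡ (f q))) ⟩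
  1ℤ *ℤ f q +ℤ + c *ℤ f q  ≡⟨ sym (ℤₚ.*-distribʳ-+ (f q) 1ℤ (+ c)) ⟩
  + suc c *ℤ f q           ∎

sum-coefficient : ∀ n (F : ℕ → Series) q → sum {suc n} (λ i → F (toℕ i)) q ≡ ∑[ i ≤ n ] F i q
sum-coefficient zero    F q = ℤₚ.+-identityʳ (F 0 q)
sum-coefficient (suc n) F q = cong (F 0 q +ℤ_) (sum-coefficient n (F ∘ suc) q)

binomial-coefficient : ∀ n x y q → ((x ⊕ y) ^ n) q ≡ ∑[ i ≤ n ] (+ (n C i) *ℤ (x ^ i ⊛ y ^ (n ∸ i)) q)
binomial-coefficient n x y q = begin
  ((x ⊕ y) ^ n) q
    ≡⟨ Binomial.theorem n x y q ⟩
  sum {suc n} (λ i → (n C toℕ i) ×ₛ (x ^ toℕ i ⊛ y ^ (n ∸ toℕ i))) q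
    ≡⟨ sum-coefficient n (λ i → (n C i) ×ₛ (x ^ i ⊛ y ^ (n ∸ i))) q ⟩
  ∑[ i ≤ n ] ((n C i) ×ₛ (x ^ i ⊛ y ^ (n ∸ i))) q
    ≡⟨ ∑-cong n (λ i _ → ×ₛ-coefficient (n C i) _ q) ⟩
  ∑[ i ≤ n ] (+ (n C i) *ℤ (x ^ i ⊛ y ^ (n ∸ i)) q) ∎

⊛-∑ˡ : ∀ n (F : ℕ → Series) g q → ((λ x → ∑[ i ≤ n ] F i x) ⊛ g) q ≡ ∑[ i ≤ n ] (F i ⊛ g) q
⊛-∑ˡ n F g q = begin
  ∑[ l ≤ q ] (∑[ i ≤ n ] F i l *ℤ g (q ∸ l))   ≡⟨ ∑-cong q (λ l _ → *-distribʳ-∑ n (g (q ∸ l)) _) ⟩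
  ∑[ l ≤ q ] ∑[ i ≤ n ] (F i l *ℤ g (q ∸ l))   ≡⟨ ∑-comm q n _ ⟩
  ∑[ i ≤ n ] ∑[ l ≤ q ] (F i l *ℤ g (q ∸ l))   ∎

⊛-∑ₗˡ : ∀ {A : Set} (F : A → Series) xs g q → ((λ x → ∑[ a ← xs ] F a x) ⊛ g) q ≡ ∑[ a ← xs ] (F a ⊛ g) q
⊛-∑ₗˡ F xs g q = begin
  ∑[ l ≤ q ] (∑[ a ← xs ] F a l *ℤ g (q ∸ l))   ≡⟨ ∑-cong q (λ l _ → *-distribʳ-∑ₗ (g (q ∸ l)) _ xs) ⟩
  ∑[ l ≤ q ] ∑[ a ← xs ] (F a l *ℤ g (q ∸ l))   ≡⟨ sym (∑ₗ-∑ q _ xs) ⟩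
  ∑[ a ← xs ] ∑[ l ≤ q ] (F a l *ℤ g (q ∸ l))   ∎

⊛-scaleˡ : ∀ c f g q → ((λ x → c *ℤ f x) ⊛ g) q ≡ c *ℤ (f ⊛ g) q
⊛-scaleˡ c f g q = trans (∑-cong q (λ l _ → ℤₚ.*-assoc c (f l) _)) (sym (*-distribˡ-∑ q c _))

infix 8 _·z^_

_·z^_ : ℤ → ℕ → Series
(c ·z^ zero)  zero    = c
(c ·z^ zero)  (suc q) = 0ℤ
(c ·z^ suc d) zero    = 0ℤ
(c ·z^ suc d) (suc q) = (c ·z^ d) q

shift : ℕ → Series → Series
shift zero    f q       = f q
shift (suc d) f zero    = 0ℤ
shift (suc d) f (suc q) = shift d f q

·z^-⊛ : ∀ c d f q → (c ·z^ d ⊛ f) q ≡ c *ℤ shift d f q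
·z^-⊛ c zero    f zero    = refl
·z^-⊛ c zero    f (suc q) = trans (cong (c *ℤ f (suc q) +ℤ_) (∑-zero q)) (ℤₚ.+-identityʳ _)
·z^-⊛ c (suc d) f zero    = sym (ℤₚ.*-zeroʳ c)
·z^-⊛ c (suc d) f (suc q) = trans (ℤₚ.+-identityˡ _) (·z^-⊛ c d f q)

shift-+ : ∀ d e f → shift d (shift e f) ≗ shift (d + e) f
shift-+ zero    e f q       = refl
shift-+ (suc d) e f zero    = refl
shift-+ (suc d) e f (suc q) = shift-+ d e f q

shift-·z^ : ∀ d c e → shift d (c ·z^ e) ≗ c ·z^ (d + e)
shift-·z^ zero    c e q       = refl
shift-·z^ (suc d) c e zero    = refl
shift-·z^ (suc d) c e (suc q) = shift-·z^ d c e q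

*-·z^ : ∀ a b d → (λ q → a *ℤ (b ·z^ d) q) ≗ (a *ℤ b) ·z^ d
*-·z^ a b zero    zero    = refl
*-·z^ a b zero    (suc q) = ℤₚ.*-zeroʳ a
*-·z^ a b (suc d) zero    = ℤₚ.*-zeroʳ a
*-·z^ a b (suc d) (suc q) = *-·z^ a b d q

·z^-⊛-·z^ : ∀ a d b e → a ·z^ d ⊛ b ·z^ e ≗ (a *ℤ b) ·z^ (d + e)
·z^-⊛-·z^ a d b e q = begin
  (a ·z^ d ⊛ b ·z^ e) q          ≡⟨ ·z^-⊛ a d _ q ⟩
  a *ℤ shift d (b ·z^ e) q       ≡⟨ cong (a *ℤ_) (shift-·z^ d b e q) ⟩
  a *ℤ (b ·z^ (d + e)) q         ≡⟨ *-·z^ a b (d + e) q ⟩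
  ((a *ℤ b) ·z^ (d + e)) q       ∎

1ₛ≗1·z^0 : 1ₛ ≗ 1ℤ ·z^ 0
1ₛ≗1·z^0 zero    = refl
1ₛ≗1·z^0 (suc q) = refl

·z^-^ : ∀ c d i → (c ·z^ d) ^ i ≗ (c ^ℤ i) ·z^ (d * i)
·z^-^ c d zero    q = trans (1ₛ≗1·z^0 q) (cong (λ e → (1ℤ ·z^ e) q) (sym (ℕₚ.*-zeroʳ d)))
·z^-^ c d (suc i) q = begin
  (c ·z^ d ⊛ (c ·z^ d) ^ i) q                ≡⟨ ⊛-congʳ (c ·z^ d) (·z^-^ c d i) q ⟩
  (c ·z^ d ⊛ (c ^ℤ i) ·z^ (d * i)) q         ≡⟨ ·z^-⊛-·z^ c d (c ^ℤ i) (d * i) q ⟩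
  ((c *ℤ c ^ℤ i) ·z^ (d + d * i)) q          ≡⟨ cong (λ e → ((c ^ℤ suc i) ·z^ e) q) (sym (ℕₚ.*-suc d i)) ⟩
  ((c ^ℤ suc i) ·z^ (d * suc i)) q           ∎

linear : ℤ → ℤ → Series
linear x y = x ·z^ 1 ⊕ y ·z^ 0

linear^-⊛ : ∀ x y u f q → (linear x y ^ u ⊛ f) q ≡
  ∑[ i ≤ u ] (+ (u C i) *ℤ (x ^ℤ i *ℤ y ^ℤ (u ∸ i) *ℤ shift i f q))
linear^-⊛ x y u f q = begin
  (linear x y ^ u ⊛ f) q
    ≡⟨ ⊛-congˡ f (binomial-coefficient u (x ·z^ 1) (y ·z^ 0)) q ⟩
  ((λ p → ∑[ i ≤ u ] (+ (u C i) *ℤ (X i ⊛ Y i) p)) ⊛ f) q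
    ≡⟨ ⊛-∑ˡ u (λ i p → + (u C i) *ℤ (X i ⊛ Y i) p) f q ⟩
  ∑[ i ≤ u ] ((λ p → + (u C i) *ℤ (X i ⊛ Y i) p) ⊛ f) q
    ≡⟨ ∑-cong u (λ i _ → trans (⊛-scaleˡ (+ (u C i)) (X i ⊛ Y i) f q) (cong (+ (u C i) *ℤ_) (term i))) ⟩
  ∑[ i ≤ u ] (+ (u C i) *ℤ (x ^ℤ i *ℤ y ^ℤ (u ∸ i) *ℤ shift i f q)) ∎
  where
  X Y : ℕ → Series
  X i = (x ·z^ 1) ^ i
  Y i = (y ·z^ 0) ^ (u ∸ i)
  monomial : ∀ i → X i ⊛ Y i ≗ (x ^ℤ i *ℤ y ^ℤ (u ∸ i)) ·z^ i
  monomial i p = begin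
    (X i ⊛ Y i) p
      ≡⟨ ⊛-cong (·z^-^ x 1 i) (·z^-^ y 0 (u ∸ i)) p ⟩
    ((x ^ℤ i) ·z^ (1 * i) ⊛ (y ^ℤ (u ∸ i)) ·z^ (0 * (u ∸ i))) p
      ≡⟨ ·z^-⊛-·z^ _ (1 * i) _ (0 * (u ∸ i)) p ⟩
    ((x ^ℤ i *ℤ y ^ℤ (u ∸ i)) ·z^ (1 * i + 0)) p
      ≡⟨ cong (λ e → ((x ^ℤ i *ℤ y ^ℤ (u ∸ i)) ·z^ e) p) (ℕₚ.+-identityʳ (1 * i)) ⟩
    ((x ^ℤ i *ℤ y ^ℤ (u ∸ i)) ·z^ (1 * i)) p
      ≡⟨ cong (λ e → ((x ^ℤ i *ℤ y ^ℤ (u ∸ i)) ·z^ e) p) (ℕₚ.*-identityˡ i) ⟩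
    ((x ^ℤ i *ℤ y ^ℤ (u ∸ i)) ·z^ i) p ∎
  term : ∀ i → (X i ⊛ Y i ⊛ f) q ≡ x ^ℤ i *ℤ y ^ℤ (u ∸ i) *ℤ shift i f q
  term i = trans (⊛-congˡ f (monomial i) q) (·z^-⊛ _ i f q)

1+z : Series
1+z = linear 1ℤ 1ℤ

1+z^-coefficient : ∀ L q → (1+z ^ L) q ≡ + (L C q)
1+z^-coefficient zero    zero    = refl
1+z^-coefficient zero    (suc q) = refl
1+z^-coefficient (suc L) q = begin
  (1+z ⊛ 1+z ^ L) q
    ≡⟨ ⊛-distribʳ (1+z ^ L) (1ℤ ·z^ 1) (1ℤ ·z^ 0) q ⟩
  (1ℤ ·z^ 1 ⊛ 1+z ^ L) q +ℤ (1ℤ ·z^ 0 ⊛ 1+z ^ L) q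
    ≡⟨ cong₂ _+ℤ_ (·z^-⊛ 1ℤ 1 (1+z ^ L) q) (·z^-⊛ 1ℤ 0 (1+z ^ L) q) ⟩
  1ℤ *ℤ shift 1 (1+z ^ L) q +ℤ 1ℤ *ℤ (1+z ^ L) q
    ≡⟨ cong₂ _+ℤ_ (ℤₚ.*-identityˡ (shift 1 (1+z ^ L) q)) (ℤₚ.*-identityˡ ((1+z ^ L) q)) ⟩
  shift 1 (1+z ^ L) q +ℤ (1+z ^ L) q
    ≡⟨ pascal q ⟩
  + (suc L C q) ∎
  where
  pascal : ∀ q → shift 1 (1+z ^ L) q +ℤ (1+z ^ L) q ≡ + (suc L C q)
  pascal zero    = trans (ℤₚ.+-identityˡ _) (1+z^-coefficient L 0)
  pascal (suc q) = begin
    (1+z ^ L) q +ℤ (1+z ^ L) (suc q)     ≡⟨ cong₂ _+ℤ_ (1+z^-coefficient L q) (1+z^-coefficient L (suc q)) ⟩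
    + (L C q) +ℤ + (L C suc q)           ≡⟨ sym (ℤₚ.pos-+ (L C q) _) ⟩
    + (L C q + L C suc q)                ≡⟨ cong +_ (nCk+nC[k+1]≡[n+1]C[k+1] L q) ⟩
    + (suc L C suc q)                    ∎

⊛-vanish : ∀ f {g} m → (∀ q → q < m → g q ≡ 0ℤ) → ∀ q → q < m → (f ⊛ g) q ≡ 0ℤ
⊛-vanish f {g} m g-vanish q q<m = trans
  (∑-cong q (λ l _ → trans (cong (f l *ℤ_) (g-vanish (q ∸ l) (ℕₚ.≤-<-trans (ℕₚ.m∸n≤m q l) q<m))) (ℤₚ.*-zeroʳ (f l))))
  (∑-zero q)

^-vanish : ∀ f → f 0 ≡ 0ℤ → ∀ m q → q < m → (f ^ m) q ≡ 0ℤ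
^-vanish f f0≡0 (suc m) zero    _ = cong (_*ℤ (f ^ m) 0) f0≡0
^-vanish f f0≡0 (suc m) (suc q) (s≤s q<m) = begin
  f 0 *ℤ (f ^ m) (suc q) +ℤ ((f ∘ suc) ⊛ f ^ m) q   ≡⟨ cong₂ _+ℤ_ (cong (_*ℤ (f ^ m) (suc q)) f0≡0)
                                                        (⊛-vanish (f ∘ suc) m (^-vanish f f0≡0 m) q q<m) ⟩
  0ℤ *ℤ (f ^ m) (suc q) +ℤ 0ℤ                        ≡⟨⟩
  0ℤ                                                  ∎

shift≗·z^-⊛ : ∀ d f → shift d f ≗ 1ℤ ·z^ d ⊛ f
shift≗·z^-⊛ d f q = trans (sym (ℤₚ.*-identityˡ (shift d f q))) (sym (·z^-⊛ 1ℤ d f q))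

shift-⊛ : ∀ d f g → shift d (f ⊛ g) ≗ f ⊛ shift d g
shift-⊛ d f g q = begin
  shift d (f ⊛ g) q        ≡⟨ shift≗·z^-⊛ d (f ⊛ g) q ⟩
  (zᵈ ⊛ (f ⊛ g)) q         ≡⟨ sym (⊛-assoc zᵈ f g q) ⟩
  (zᵈ ⊛ f ⊛ g) q           ≡⟨ ⊛-congˡ g (⊛-comm zᵈ f) q ⟩
  (f ⊛ zᵈ ⊛ g) q           ≡⟨ ⊛-assoc f zᵈ g q ⟩
  (f ⊛ (zᵈ ⊛ g)) q         ≡⟨ ⊛-congʳ f (λ x → sym (shift≗·z^-⊛ d g x)) q ⟩
  (f ⊛ shift d g) q        ∎
  where
  zᵈ : Series
  zᵈ = 1ℤ ·z^ d

-- Words, their links, and the complement map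

ι : Bool → ℤ
ι true  = 1ℤ
ι false = 0ℤ

+-length-filterᵇ : ∀ {A : Set} (P : A → Bool) xs → + length (filterᵇ P xs) ≡ ∑[ x ← xs ] ι (P x)
+-length-filterᵇ P []       = refl
+-length-filterᵇ P (x ∷ xs) with P x
... | true  = trans (ℤₚ.pos-+ 1 _) (cong (1ℤ +ℤ_) (+-length-filterᵇ P xs))
... | false = trans (+-length-filterᵇ P xs) (sym (ℤₚ.+-identityˡ _))

countWords-∑ : ∀ N n f p → + countWords N n f p ≡ ∑[ π ← words N n ] ι (f π ≡ᵇ p)
countWords-∑ N n f p = +-length-filterᵇ (λ π → f π ≡ᵇ p) (words N n)

applyUpTo-cong : ∀ {A : Set} {f g : ℕ → A} n → (∀ i → f i ≡ g i) → applyUpTo f n ≡ applyUpTo g n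
applyUpTo-cong zero    f≗g = refl
applyUpTo-cong (suc n) f≗g = cong₂ _∷_ (f≗g 0) (applyUpTo-cong n (f≗g ∘ suc))

applyUpTo-unique : (go : ℕ → ℕ → List ℕ) → (∀ a → go a 0 ≡ []) → (∀ a k → go a (suc k) ≡ a ∷ go (suc a) k) →
                   ∀ a k → go a k ≡ applyUpTo (λ i → a + i) k
applyUpTo-unique go go-0 go-suc a zero    = go-0 a
applyUpTo-unique go go-0 go-suc a (suc k) = trans (go-suc a k) (cong₂ _∷_ (sym (ℕₚ.+-identityʳ a))
  (trans (applyUpTo-unique go go-0 go-suc (suc a) k) (applyUpTo-cong k (λ i → sym (ℕₚ.+-suc a i)))))

-- `letters` is built by a local helper; abstracting its arguments makes `applyUpTo-unique` applicable to it.
letters≡applyUpTo : ∀ N → letters N ≡ applyUpTo suc N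
letters≡applyUpTo zero          = refl
letters≡applyUpTo (suc zero)    = refl
letters≡applyUpTo (suc (suc N)) with suc N
... | _ with applyUpTo-unique _ (λ _ → refl) (λ _ _ → refl) | 3 in 3≡a | N
...   | unique | a | k = cong (λ w → 1 ∷ 2 ∷ w) (trans (unique a k) (cong (λ b → applyUpTo (λ i → b + i) k) (sym 3≡a)))

∈-letters : ∀ {N a} → a ∈ letters N → 1 ≤ a × a ≤ N
∈-letters {N} a∈ with ∈-applyUpTo⁻ suc (subst (_ ∈_) (letters≡applyUpTo N) a∈)
... | i , i<N , refl = s≤s z≤n , i<N

∑-words-suc : ∀ N n (f : List ℕ → ℤ) →
  ∑ₗ f (words N (suc n)) ≡ ∑[ a ← letters N ] ∑[ π ← words N n ] f (a ∷ π)
∑-words-suc N n f = trans (∑ₗ-concatMap f (λ a → map (a ∷_) (words N n)) (letters N))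
  (∑ₗ-cong (letters N) (λ a _ → ∑ₗ-map f (a ∷_) (words N n)))

∈-words : ∀ {N n π} → π ∈ words N n → length π ≡ n × All (_∈ letters N) π
∈-words {n = zero}  (here refl) = refl , []
∈-words {N} {suc n} π∈ with find (∈-concatMap⁻ (λ a → map (a ∷_) (words N n)) {xs = letters N} π∈)
... | a , a∈ , π∈′ with ∈-map⁻ (a ∷_) π∈′
...   | ρ , ρ∈ , refl = cong suc (proj₁ (∈-words {N} {n} ρ∈)) , a∈ ∷ proj₂ (∈-words {N} {n} ρ∈)

applyUpTo-∸≡applyDownFrom : ∀ N → applyUpTo (λ i → N ∸ i) N ≡ applyDownFrom suc N
applyUpTo-∸≡applyDownFrom zero    = refl
applyUpTo-∸≡applyDownFrom (suc N) = cong (suc N ∷_) (applyUpTo-∸≡applyDownFrom N)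

complement : ℕ → ℕ → ℕ
complement N a = suc N ∸ a

complement-<ᵇ : ∀ N {x y} → y ≤ suc N → (x <ᵇ y) ≡ (complement N y <ᵇ complement N x)
complement-<ᵇ N {x} {y} y≤1+N with x <? y
... | yes x<y = trans (dec-true (x <? y) x<y) (sym (dec-true (complement N y <? complement N x) (ℕₚ.∸-monoʳ-< x<y y≤1+N)))
... | no  x≮y = trans (dec-false (x <? y) x≮y) (sym (dec-false (complement N y <? complement N x) (x≮y ∘ ℕₚ.∸-cancelʳ-<)))

complement-involutive : ∀ N {x} → x ≤ suc N → complement N (complement N x) ≡ x
complement-involutive N = ℕₚ.m∸[m∸n]≡n

∑-letters-complement : ∀ N (h : ℕ → ℤ) → ∑[ a ← letters N ] h (complement N a) ≡ ∑ₗ h (letters N)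
∑-letters-complement N h = begin
  ∑ₗ (h ∘ complement N) (letters N)                  ≡⟨ cong (∑ₗ (h ∘ complement N)) (letters≡applyUpTo N) ⟩
  ∑ₗ (h ∘ complement N) (applyUpTo suc N)            ≡⟨ sym (∑ₗ-map h (complement N) (applyUpTo suc N)) ⟩
  ∑ₗ h (map (complement N) (applyUpTo suc N))        ≡⟨ cong (∑ₗ h) (Listₚ.map-applyUpTo suc (complement N) N) ⟩
  ∑ₗ h (applyUpTo (λ i → N ∸ i) N)                   ≡⟨ cong (∑ₗ h) (applyUpTo-∸≡applyDownFrom N) ⟩
  ∑ₗ h (applyDownFrom suc N)                         ≡⟨ cong (∑ₗ h) (sym (Listₚ.reverse-applyUpTo suc N)) ⟩
  ∑ₗ h (reverse (applyUpTo suc N))                   ≡⟨ ∑ₗ-reverse h (applyUpTo suc N) ⟩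
  ∑ₗ h (applyUpTo suc N)                             ≡⟨ cong (∑ₗ h) (sym (letters≡applyUpTo N)) ⟩
  ∑ₗ h (letters N)                                   ∎

∑-words-complement : ∀ N n (g : List ℕ → ℤ) → ∑[ π ← words N n ] g (map (complement N) π) ≡ ∑ₗ g (words N n)
∑-words-complement N zero    g = refl
∑-words-complement N (suc n) g = begin
  ∑[ π ← words N (suc n) ] g (map (complement N) π)
    ≡⟨ ∑-words-suc N n (g ∘ map (complement N)) ⟩
  ∑[ a ← letters N ] ∑[ π ← words N n ] g (complement N a ∷ map (complement N) π)
    ≡⟨ ∑ₗ-cong (letters N) (λ a _ → ∑-words-complement N n (λ π → g (complement N a ∷ π))) ⟩
  ∑[ a ← letters N ] ∑[ π ← words N n ] g (complement N a ∷ π)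
    ≡⟨ ∑-letters-complement N (λ a → ∑[ π ← words N n ] g (a ∷ π)) ⟩
  ∑[ a ← letters N ] ∑[ π ← words N n ] g (a ∷ π)
    ≡⟨ sym (∑-words-suc N n g) ⟩
  ∑ₗ g (words N (suc n)) ∎

links : (ℕ → ℕ → Bool) → List ℕ → ℕ
links R (a ∷ b ∷ w) = (if R a b then 1 else 0) + links R (b ∷ w)
links R _           = 0

links-∷-≤ : ∀ R a π → links R (a ∷ π) ≤ length π
links-∷-≤ R a []      = z≤n
links-∷-≤ R a (b ∷ w) with R a b
... | true  = s≤s (links-∷-≤ R b w)
... | false = ℕₚ.m≤n⇒m≤1+n (links-∷-≤ R b w)

links-map : ∀ {R R′ : ℕ → ℕ → Bool} {L} (f : ℕ → ℕ) → (∀ {a b} → a ∈ L → b ∈ L → R′ a b ≡ R (f a) (f b)) →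
  ∀ {π} → All (_∈ L) π → links R′ π ≡ links R (map f π)
links-map f R′≡R []                   = refl
links-map f R′≡R (_ ∷ [])             = refl
links-map f R′≡R (a∈ ∷ b∈ ∷ w∈) =
  cong₂ (λ c m → (if c then 1 else 0) + m) (R′≡R a∈ b∈) (links-map f R′≡R (b∈ ∷ w∈))

desR≡links : ∀ s .{{_ : NonZero s}} c π → desR s c π ≡ links (λ x y → (y <ᵇ x) ∧ inR s c x) π
desR≡links s c []          = refl
desR≡links s c (x ∷ [])    = refl
desR≡links s c (x ∷ y ∷ w) = cong (λ m → (if (y <ᵇ x) ∧ inR s c x then 1 else 0) + m) (desR≡links s c (y ∷ w))

risR≡links : ∀ s .{{_ : NonZero s}} c π → risR s c π ≡ links (λ x y → (x <ᵇ y) ∧ inR s c x) π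
risR≡links s c []          = refl
risR≡links s c (x ∷ [])    = refl
risR≡links s c (x ∷ y ∷ w) = cong (λ m → (if (x <ᵇ y) ∧ inR s c x then 1 else 0) + m) (risR≡links s c (y ∷ w))

-- Counting words by their number of links

δ : ℕ → ℕ → ℤ
δ d p = ι (d ≡ᵇ p)

pascal⁻¹ : ℕ → ℕ → ℤ
pascal⁻¹ i p = sign (i + p) *ℤ + (i C p)

pascal⁻¹-suc-zero : ∀ i → pascal⁻¹ (suc i) 0 ≡ -1ℤ *ℤ pascal⁻¹ i 0
pascal⁻¹-suc-zero i = ℤₚ.*-assoc -1ℤ (sign (i + 0)) 1ℤ

pascal⁻¹-suc-suc : ∀ i p → pascal⁻¹ (suc i) (suc p) ≡ pascal⁻¹ i p +ℤ -1ℤ *ℤ pascal⁻¹ i (suc p)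
pascal⁻¹-suc-suc i p = begin
  sign (suc i + suc p) *ℤ + (suc i C suc p)
    ≡⟨ cong₂ _*ℤ_ (cong (λ e → -1ℤ *ℤ sign e) (ℕₚ.+-suc i p)) (sym (cong +_ (nCk+nC[k+1]≡[n+1]C[k+1] i p))) ⟩
  -1ℤ *ℤ (-1ℤ *ℤ sign (i + p)) *ℤ + (i C p + i C suc p)
    ≡⟨ cong (-1ℤ *ℤ (-1ℤ *ℤ sign (i + p)) *ℤ_) (ℤₚ.pos-+ (i C p) _) ⟩
  -1ℤ *ℤ (-1ℤ *ℤ sign (i + p)) *ℤ (+ (i C p) +ℤ + (i C suc p))
    ≡⟨ solve 3 (λ σ x y → con -1ℤ :* (con -1ℤ :* σ) :* (x :+ y) := σ :* x :+ con -1ℤ :* ((con -1ℤ :* σ) :* y))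
             refl (sign (i + p)) (+ (i C p)) (+ (i C suc p)) ⟩
  sign (i + p) *ℤ + (i C p) +ℤ -1ℤ *ℤ (-1ℤ *ℤ sign (i + p) *ℤ + (i C suc p))
    ≡⟨ cong (λ e → pascal⁻¹ i p +ℤ -1ℤ *ℤ (sign e *ℤ + (i C suc p))) (sym (ℕₚ.+-suc i p)) ⟩
  pascal⁻¹ i p +ℤ -1ℤ *ℤ pascal⁻¹ i (suc p) ∎
  where open ℤ-Solver

inversion-pascal : ∀ p d M → ∑[ i ≤ suc M ] (pascal⁻¹ i p *ℤ + (suc d C i)) ≡
  ∑[ i ≤ suc M ] (pascal⁻¹ i p *ℤ + (d C i)) +ℤ ∑[ i ≤ M ] (pascal⁻¹ (suc i) p *ℤ + (d C i))
inversion-pascal p d M = begin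
  c 0 *ℤ 1ℤ +ℤ ∑[ i ≤ M ] (c (suc i) *ℤ + (suc d C suc i))
    ≡⟨ cong (c 0 *ℤ 1ℤ +ℤ_) (trans (∑-cong M (λ i _ → split i)) (∑-+ M _ _)) ⟩
  c 0 *ℤ 1ℤ +ℤ (∑[ i ≤ M ] (c (suc i) *ℤ + (d C suc i)) +ℤ ∑[ i ≤ M ] (c (suc i) *ℤ + (d C i)))
    ≡⟨ sym (ℤₚ.+-assoc (c 0 *ℤ 1ℤ) _ _) ⟩
  ∑[ i ≤ suc M ] (c i *ℤ + (d C i)) +ℤ ∑[ i ≤ M ] (c (suc i) *ℤ + (d C i)) ∎
  where
  c : ℕ → ℤ
  c i = pascal⁻¹ i p
  split : ∀ i → c (suc i) *ℤ + (suc d C suc i) ≡ c (suc i) *ℤ + (d C suc i) +ℤ c (suc i) *ℤ + (d C i)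
  split i = begin
    c (suc i) *ℤ + (suc d C suc i)
      ≡⟨ cong (λ x → c (suc i) *ℤ + x) (sym (nCk+nC[k+1]≡[n+1]C[k+1] d i)) ⟩
    c (suc i) *ℤ + (d C i + d C suc i)
      ≡⟨ cong (c (suc i) *ℤ_) (ℤₚ.pos-+ (d C i) (d C suc i)) ⟩
    c (suc i) *ℤ (+ (d C i) +ℤ + (d C suc i))
      ≡⟨ ℤₚ.*-distribˡ-+ (c (suc i)) (+ (d C i)) (+ (d C suc i)) ⟩
    c (suc i) *ℤ + (d C i) +ℤ c (suc i) *ℤ + (d C suc i)
      ≡⟨ ℤₚ.+-comm (c (suc i) *ℤ + (d C i)) _ ⟩
    c (suc i) *ℤ + (d C suc i) +ℤ c (suc i) *ℤ + (d C i) ∎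

pascal⁻¹-zero : ∀ p → pascal⁻¹ 0 p *ℤ 1ℤ ≡ δ 0 p
pascal⁻¹-zero zero    = refl
pascal⁻¹-zero (suc p) = cong (_*ℤ 1ℤ) (ℤₚ.*-zeroʳ (sign (suc p)))

binomial-inversion : ∀ p d M → d ≤ M → ∑[ i ≤ M ] (pascal⁻¹ i p *ℤ + (d C i)) ≡ δ d p
binomial-inversion p zero zero    _ = pascal⁻¹-zero p
binomial-inversion p zero (suc M) _ = begin
  pascal⁻¹ 0 p *ℤ 1ℤ +ℤ ∑[ i ≤ M ] (pascal⁻¹ (suc i) p *ℤ 0ℤ)
    ≡⟨ cong₂ _+ℤ_ (pascal⁻¹-zero p) (trans (∑-cong M (λ i _ → ℤₚ.*-zeroʳ (pascal⁻¹ (suc i) p))) (∑-zero M)) ⟩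
  δ 0 p +ℤ 0ℤ
    ≡⟨ ℤₚ.+-identityʳ (δ 0 p) ⟩
  δ 0 p ∎
binomial-inversion zero (suc d) (suc M) (s≤s d≤M) = begin
  ∑[ i ≤ suc M ] (pascal⁻¹ i 0 *ℤ + (suc d C i))
    ≡⟨ inversion-pascal 0 d M ⟩
  ∑[ i ≤ suc M ] (pascal⁻¹ i 0 *ℤ + (d C i)) +ℤ ∑[ i ≤ M ] (pascal⁻¹ (suc i) 0 *ℤ + (d C i))
    ≡⟨ cong₂ _+ℤ_ (binomial-inversion 0 d (suc M) (ℕₚ.m≤n⇒m≤1+n d≤M)) shifted ⟩
  δ d 0 +ℤ -1ℤ *ℤ δ d 0
    ≡⟨ solve 1 (λ x → x :+ con -1ℤ :* x := con 0ℤ) refl (δ d 0) ⟩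
  0ℤ ∎
  where
  open ℤ-Solver
  shifted : ∑[ i ≤ M ] (pascal⁻¹ (suc i) 0 *ℤ + (d C i)) ≡ -1ℤ *ℤ δ d 0
  shifted = begin
    ∑[ i ≤ M ] (pascal⁻¹ (suc i) 0 *ℤ + (d C i))          ≡⟨ ∑-cong M (λ i _ → trans (cong (_*ℤ + (d C i)) (pascal⁻¹-suc-zero i))
                                                                                (ℤₚ.*-assoc -1ℤ (pascal⁻¹ i 0) (+ (d C i)))) ⟩
    ∑[ i ≤ M ] (-1ℤ *ℤ (pascal⁻¹ i 0 *ℤ + (d C i)))        ≡⟨ sym (*-distribˡ-∑ M -1ℤ _) ⟩
    -1ℤ *ℤ ∑[ i ≤ M ] (pascal⁻¹ i 0 *ℤ + (d C i))          ≡⟨ cong (-1ℤ *ℤ_) (binomial-inversion 0 d M d≤M) ⟩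
    -1ℤ *ℤ δ d 0                                            ∎
binomial-inversion (suc p) (suc d) (suc M) (s≤s d≤M) = begin
  ∑[ i ≤ suc M ] (pascal⁻¹ i (suc p) *ℤ + (suc d C i))
    ≡⟨ inversion-pascal (suc p) d M ⟩
  ∑[ i ≤ suc M ] (pascal⁻¹ i (suc p) *ℤ + (d C i)) +ℤ ∑[ i ≤ M ] (pascal⁻¹ (suc i) (suc p) *ℤ + (d C i))
    ≡⟨ cong₂ _+ℤ_ (binomial-inversion (suc p) d (suc M) (ℕₚ.m≤n⇒m≤1+n d≤M)) shifted ⟩
  δ d (suc p) +ℤ (δ d p +ℤ -1ℤ *ℤ δ d (suc p))
    ≡⟨ solve 2 (λ x y → x :+ (y :+ con -1ℤ :* x) := y) refl (δ d (suc p)) (δ d p) ⟩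
  δ d p ∎
  where
  open ℤ-Solver
  shifted : ∑[ i ≤ M ] (pascal⁻¹ (suc i) (suc p) *ℤ + (d C i)) ≡ δ d p +ℤ -1ℤ *ℤ δ d (suc p)
  shifted = begin
    ∑[ i ≤ M ] (pascal⁻¹ (suc i) (suc p) *ℤ + (d C i))
      ≡⟨ ∑-cong M (λ i _ → trans (cong (_*ℤ + (d C i)) (pascal⁻¹-suc-suc i p))
                                 (solve 3 (λ a b x → (a :+ con -1ℤ :* b) :* x := a :* x :+ con -1ℤ :* (b :* x)) refl
                                        (pascal⁻¹ i p) (pascal⁻¹ i (suc p)) (+ (d C i)))) ⟩
    ∑[ i ≤ M ] (pascal⁻¹ i p *ℤ + (d C i) +ℤ -1ℤ *ℤ (pascal⁻¹ i (suc p) *ℤ + (d C i)))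
      ≡⟨ trans (∑-+ M _ _) (cong (∑[ i ≤ M ] (pascal⁻¹ i p *ℤ + (d C i)) +ℤ_) (sym (*-distribˡ-∑ M -1ℤ _))) ⟩
    ∑[ i ≤ M ] (pascal⁻¹ i p *ℤ + (d C i)) +ℤ -1ℤ *ℤ ∑[ i ≤ M ] (pascal⁻¹ i (suc p) *ℤ + (d C i))
      ≡⟨ cong₂ (λ x y → x +ℤ -1ℤ *ℤ y) (binomial-inversion p d M d≤M) (binomial-inversion (suc p) d M d≤M) ⟩
    δ d p +ℤ -1ℤ *ℤ δ d (suc p) ∎

links-≤ : ∀ R π → links R π ≤ length π
links-≤ R []      = z≤n
links-≤ R (a ∷ π) = ℕₚ.m≤n⇒m≤1+n (links-∷-≤ R a π)

ι-pascal : ∀ c d i → + (((if c then 1 else 0) + d) C suc i) ≡ + (d C suc i) +ℤ ι c *ℤ + (d C i)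
ι-pascal true  d i = begin
  + (suc d C suc i)              ≡⟨ cong +_ (sym (nCk+nC[k+1]≡[n+1]C[k+1] d i)) ⟩
  + (d C i + d C suc i)          ≡⟨ ℤₚ.pos-+ (d C i) (d C suc i) ⟩
  + (d C i) +ℤ + (d C suc i)     ≡⟨ ℤₚ.+-comm (+ (d C i)) (+ (d C suc i)) ⟩
  + (d C suc i) +ℤ + (d C i)     ≡⟨ cong (+ (d C suc i) +ℤ_) (sym (ℤₚ.*-identityˡ (+ (d C i)))) ⟩
  + (d C suc i) +ℤ 1ℤ *ℤ + (d C i) ∎
ι-pascal false d i = sym (ℤₚ.+-identityʳ (+ (d C suc i)))

module LinkStatistics (N : ℕ) (R : ℕ → ℕ → Bool) where

  chains : ℕ → Series
  chains a zero    = 1ℤ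
  chains a (suc ℓ) = ∑[ b ← letters N ] (ι (R a b) *ℤ chains b ℓ)

  blocks : Series
  blocks zero    = 0ℤ
  blocks (suc ℓ) = ∑[ a ← letters N ] chains a ℓ

  marked : ℕ → ℕ → ℤ
  marked n i = ∑[ π ← words N n ] (+ (links R π C i))

  markedAfter : ℕ → ℕ → ℕ → ℤ
  markedAfter a n i = ∑[ π ← words N n ] (+ (links R (a ∷ π) C i))

  chains-⊛-suc : ∀ a g n → (chains a ⊛ g) (suc n) ≡ g (suc n) +ℤ ∑[ b ← letters N ] (ι (R a b) *ℤ (chains b ⊛ g) n)
  chains-⊛-suc a g n = cong₂ _+ℤ_ (ℤₚ.*-identityˡ (g (suc n))) (begin
    ((λ ℓ → ∑[ b ← letters N ] (ι (R a b) *ℤ chains b ℓ)) ⊛ g) n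
      ≡⟨ ⊛-∑ₗˡ (λ b ℓ → ι (R a b) *ℤ chains b ℓ) (letters N) g n ⟩
    ∑[ b ← letters N ] ((λ ℓ → ι (R a b) *ℤ chains b ℓ) ⊛ g) n
      ≡⟨ ∑ₗ-cong (letters N) (λ b _ → ⊛-scaleˡ (ι (R a b)) (chains b) g n) ⟩
    ∑[ b ← letters N ] (ι (R a b) *ℤ (chains b ⊛ g) n) ∎)

  blocks-⊛-suc : ∀ g n → (blocks ⊛ g) (suc n) ≡ ∑[ a ← letters N ] (chains a ⊛ g) n
  blocks-⊛-suc g n = trans (ℤₚ.+-identityˡ _) (⊛-∑ₗˡ chains (letters N) g n)

  blocks^-vanish : ∀ m q → q < m → (blocks ^ m) q ≡ 0ℤ
  blocks^-vanish = ^-vanish blocks refl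

  markedAfter-suc-zero : ∀ a n → markedAfter a (suc n) 0 ≡ ∑[ b ← letters N ] markedAfter b n 0
  markedAfter-suc-zero a n = ∑-words-suc N n (λ π → + (links R (a ∷ π) C 0))

  markedAfter-suc : ∀ a n i → markedAfter a (suc n) (suc i) ≡
    ∑[ b ← letters N ] markedAfter b n (suc i) +ℤ ∑[ b ← letters N ] (ι (R a b) *ℤ markedAfter b n i)
  markedAfter-suc a n i = begin
    markedAfter a (suc n) (suc i)
      ≡⟨ ∑-words-suc N n (λ π → + (links R (a ∷ π) C suc i)) ⟩
    ∑[ b ← letters N ] ∑[ π ← words N n ] (+ (links R (a ∷ b ∷ π) C suc i))
      ≡⟨ ∑ₗ-cong (letters N) (λ b _ → ∑ₗ-cong (words N n) (λ π _ → ι-pascal (R a b) (links R (b ∷ π)) i)) ⟩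
    ∑[ b ← letters N ] ∑[ π ← words N n ] (+ (links R (b ∷ π) C suc i) +ℤ ι (R a b) *ℤ + (links R (b ∷ π) C i))
      ≡⟨ ∑ₗ-cong (letters N) (λ b _ → trans (∑ₗ-+ _ _ (words N n))
           (cong (markedAfter b n (suc i) +ℤ_) (sym (*-distribˡ-∑ₗ (ι (R a b)) _ (words N n))))) ⟩
    ∑[ b ← letters N ] (markedAfter b n (suc i) +ℤ ι (R a b) *ℤ markedAfter b n i)
      ≡⟨ ∑ₗ-+ _ _ (letters N) ⟩
    ∑[ b ← letters N ] markedAfter b n (suc i) +ℤ ∑[ b ← letters N ] (ι (R a b) *ℤ markedAfter b n i) ∎

  markedAfter-vanish : ∀ a n i → n < i → markedAfter a n i ≡ 0ℤ
  markedAfter-vanish a n i n<i = trans (∑ₗ-cong (words N n) vanish) (∑ₗ-zero (words N n))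
    where
    vanish : ∀ π → π ∈ words N n → + (links R (a ∷ π) C i) ≡ 0ℤ
    vanish π π∈ = cong +_ (k>n⇒nCk≡0 (ℕₚ.≤-<-trans (links-∷-≤ R a π) (subst (_< i) (sym (proj₁ (∈-words π∈))) n<i)))

  -- The block of a ∷ π starting at a is a chain counted by `chains a`; the remaining letters form m blocks.
  markedAfter-blocks : ∀ n a i m → i + m ≡ n → markedAfter a n i ≡ (chains a ⊛ blocks ^ m) n
  ∑-markedAfter-blocks : ∀ n i m → i + m ≡ n → ∑[ a ← letters N ] markedAfter a n i ≡ (blocks ^ suc m) (suc n)

  markedAfter-blocks zero    a zero    zero refl = refl
  markedAfter-blocks (suc n) a zero    _    refl = begin
    markedAfter a (suc n) 0
      ≡⟨ markedAfter-suc-zero a n ⟩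
    ∑[ b ← letters N ] markedAfter b n 0
      ≡⟨ ∑-markedAfter-blocks n 0 n refl ⟩
    (blocks ^ suc n) (suc n)
      ≡⟨ sym (ℤₚ.+-identityʳ _) ⟩
    (blocks ^ suc n) (suc n) +ℤ 0ℤ
      ≡⟨ cong ((blocks ^ suc n) (suc n) +ℤ_) (sym (trans (∑ₗ-cong (letters N) vanish) (∑ₗ-zero (letters N)))) ⟩
    (blocks ^ suc n) (suc n) +ℤ ∑[ b ← letters N ] (ι (R a b) *ℤ (chains b ⊛ blocks ^ suc n) n)
                                              ≡⟨ sym (chains-⊛-suc a (blocks ^ suc n) n) ⟩
    (chains a ⊛ blocks ^ suc n) (suc n) ∎
    where
    vanish : ∀ b → b ∈ letters N → ι (R a b) *ℤ (chains b ⊛ blocks ^ suc n) n ≡ 0ℤ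
    vanish b _ = trans (cong (ι (R a b) *ℤ_) (⊛-vanish (chains b) (suc n) (blocks^-vanish (suc n)) n (ℕₚ.n<1+n n)))
                       (ℤₚ.*-zeroʳ (ι (R a b)))
  markedAfter-blocks (suc n) a (suc i) m    i+m≡n = begin
    markedAfter a (suc n) (suc i)
      ≡⟨ markedAfter-suc a n i ⟩
    ∑[ b ← letters N ] markedAfter b n (suc i) +ℤ ∑[ b ← letters N ] (ι (R a b) *ℤ markedAfter b n i)
      ≡⟨ cong₂ _+ℤ_ (unmarkedFirst m i+m≡n′)
           (∑ₗ-cong (letters N) (λ b _ → cong (ι (R a b) *ℤ_) (markedAfter-blocks n b i m i+m≡n′))) ⟩
    (blocks ^ m) (suc n) +ℤ ∑[ b ← letters N ] (ι (R a b) *ℤ (chains b ⊛ blocks ^ m) n)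
      ≡⟨ sym (chains-⊛-suc a (blocks ^ m) n) ⟩
    (chains a ⊛ blocks ^ m) (suc n) ∎
    where
    i+m≡n′ : i + m ≡ n
    i+m≡n′ = ℕₚ.suc-injective i+m≡n
    unmarkedFirst : ∀ m → i + m ≡ n → ∑[ b ← letters N ] markedAfter b n (suc i) ≡ (blocks ^ m) (suc n)
    unmarkedFirst zero    i+0≡n = trans (∑ₗ-cong (letters N) (λ b _ → markedAfter-vanish b n (suc i) n<1+i)) (∑ₗ-zero (letters N))
      where
      n<1+i : n < suc i
      n<1+i = s≤s (ℕₚ.≤-reflexive (trans (sym i+0≡n) (ℕₚ.+-identityʳ i)))
    unmarkedFirst (suc m) i+1+m≡n = ∑-markedAfter-blocks n (suc i) m (trans (sym (ℕₚ.+-suc i m)) i+1+m≡n)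

  ∑-markedAfter-blocks n i m i+m≡n = begin
    ∑[ a ← letters N ] markedAfter a n i
      ≡⟨ ∑ₗ-cong (letters N) (λ a _ → markedAfter-blocks n a i m i+m≡n) ⟩
    ∑[ a ← letters N ] (chains a ⊛ blocks ^ m) n
      ≡⟨ sym (blocks-⊛-suc (blocks ^ m) n) ⟩
    (blocks ^ suc m) (suc n) ∎

  marked-blocks : ∀ n i → i ≤ n → marked n i ≡ (blocks ^ (n ∸ i)) n
  marked-blocks zero    zero    _ = refl
  marked-blocks (suc n) i i≤1+n with ℕₚ.m≤n⇒m<n∨m≡n i≤1+n
  ... | inj₁ (s≤s i≤n) = begin
    marked (suc n) i
      ≡⟨ ∑-words-suc N n (λ π → + (links R π C i)) ⟩
    ∑[ a ← letters N ] markedAfter a n i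
      ≡⟨ ∑-markedAfter-blocks n i (n ∸ i) (ℕₚ.m+[n∸m]≡n i≤n) ⟩
    (blocks ^ suc (n ∸ i)) (suc n)
      ≡⟨ cong (λ e → (blocks ^ e) (suc n)) (sym (ℕₚ.+-∸-assoc 1 i≤n)) ⟩
    (blocks ^ (suc n ∸ i)) (suc n) ∎
  ... | inj₂ refl = begin
    marked (suc n) (suc n)
      ≡⟨ ∑-words-suc N n (λ π → + (links R π C suc n)) ⟩
    ∑[ a ← letters N ] markedAfter a n (suc n)
      ≡⟨ ∑ₗ-cong (letters N) (λ a _ → markedAfter-vanish a n (suc n) (ℕₚ.n<1+n n)) ⟩
    ∑[ a ← letters N ] 0ℤ
      ≡⟨ ∑ₗ-zero (letters N) ⟩
    0ℤ
      ≡⟨ cong (λ e → (blocks ^ e) (suc n)) (sym (ℕₚ.n∸n≡0 n)) ⟩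
    (blocks ^ (n ∸ n)) (suc n) ∎

  links-distribution : ∀ n p → ∑[ π ← words N n ] δ (links R π) p ≡
    ∑[ m ≤ n ] (pascal⁻¹ (n ∸ m) p *ℤ (blocks ^ m) n)
  links-distribution n p = begin
    ∑[ π ← words N n ] δ (links R π) p
      ≡⟨ ∑ₗ-cong (words N n) (λ π π∈ → sym (binomial-inversion p (links R π) n
           (subst (links R π ≤_) (proj₁ (∈-words π∈)) (links-≤ R π)))) ⟩
    ∑[ π ← words N n ] ∑[ i ≤ n ] (pascal⁻¹ i p *ℤ + (links R π C i))
      ≡⟨ ∑ₗ-∑ n _ (words N n) ⟩
    ∑[ i ≤ n ] ∑[ π ← words N n ] (pascal⁻¹ i p *ℤ + (links R π C i))
      ≡⟨ ∑-cong n (λ i i≤n → trans (sym (*-distribˡ-∑ₗ (pascal⁻¹ i p) _ (words N n)))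
                                   (cong (pascal⁻¹ i p *ℤ_) (marked-blocks n i i≤n))) ⟩
    ∑[ i ≤ n ] (pascal⁻¹ i p *ℤ (blocks ^ (n ∸ i)) n)
      ≡⟨ ∑-reverse n _ ⟩
    ∑[ m ≤ n ] (pascal⁻¹ (n ∸ m) p *ℤ (blocks ^ (n ∸ (n ∸ m))) n)
      ≡⟨ ∑-cong n (λ m m≤n → cong (λ e → pascal⁻¹ (n ∸ m) p *ℤ (blocks ^ e) n) (ℕₚ.m∸[m∸n]≡n m≤n)) ⟩
    ∑[ m ≤ n ] (pascal⁻¹ (n ∸ m) p *ℤ (blocks ^ m) n) ∎

-- Powers of the block series (bz + s)(1 + z)^K - az - s

shift-1+z^ : ∀ L d q → shift d (1+z ^ L) q ≡ + binomℤ L (+ q - + d)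
shift-1+z^ L zero    q       = trans (1+z^-coefficient L q) (cong (+_ ∘ binomℤ L) (sym (ℤₚ.+-identityʳ (+ q))))
shift-1+z^ L (suc d) zero    = refl
shift-1+z^ L (suc d) (suc q) = trans (shift-1+z^ L d q) (cong (+_ ∘ binomℤ L) (sym suc-minus-suc))
  where
  suc-minus-suc : + suc q - + suc d ≡ + q - + d
  suc-minus-suc = trans (ℤₚ.m-n≡m⊖n (suc q) (suc d)) (trans (ℤₚ.[1+m]⊖[1+n]≡m⊖n q d) (sym (ℤₚ.m-n≡m⊖n q d)))

pos-^ : ∀ x e → + (x ℕ.^ e) ≡ (+ x) ^ℤ e
pos-^ x zero    = refl
pos-^ x (suc e) = trans (ℤₚ.pos-* x _) (cong (+ x *ℤ_) (pos-^ x e))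

neg-^ : ∀ x e → (- x) ^ℤ e ≡ sign e *ℤ x ^ℤ e
neg-^ x zero    = refl
neg-^ x (suc e) = begin
  - x *ℤ (- x) ^ℤ e
    ≡⟨ cong₂ _*ℤ_ (sym (ℤₚ.-1*i≡-i x)) (neg-^ x e) ⟩
  -1ℤ *ℤ x *ℤ (sign e *ℤ x ^ℤ e)
    ≡⟨ solve 4 (λ m x σ y → m :* x :* (σ :* y) := m :* σ :* (x :* y)) refl -1ℤ x (sign e) (x ^ℤ e) ⟩
  sign (suc e) *ℤ x ^ℤ suc e ∎
  where open ℤ-Solver

sign-+ : ∀ e f → sign (e + f) ≡ sign e *ℤ sign f
sign-+ = ℤₚ.^-distribˡ-+-* (- + 1)

sign-even : ∀ e f → sign (e + f + f) ≡ sign e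
sign-even e zero    = cong sign (trans (ℕₚ.+-identityʳ (e + 0)) (ℕₚ.+-identityʳ e))
sign-even e (suc f) = begin
  sign (e + suc f + suc f)              ≡⟨ cong sign (ℕₚ.+-suc (e + suc f) f) ⟩
  -1ℤ *ℤ sign (e + suc f + f)           ≡⟨ cong (λ x → -1ℤ *ℤ sign (x + f)) (ℕₚ.+-suc e f) ⟩
  -1ℤ *ℤ (-1ℤ *ℤ sign (e + f + f))      ≡⟨ sym (ℤₚ.*-assoc -1ℤ -1ℤ _) ⟩
  1ℤ *ℤ sign (e + f + f)                ≡⟨ ℤₚ.*-identityˡ _ ⟩
  sign (e + f + f)                      ≡⟨ sign-even e f ⟩
  sign e                                ∎

pos-*ˡ : ∀ {x} {X : ℤ} y → + x ≡ X → + (x * y) ≡ X *ℤ + y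
pos-*ˡ {x} y +x≡X = trans (ℤₚ.pos-* x y) (cong (_*ℤ + y) +x≡X)

m∸i₁∸i₂≡[m∸j∸i₁]+[j∸i₂] : ∀ m j i₁ i₂ → j ≤ m → i₁ ≤ m ∸ j → i₂ ≤ j → m ∸ i₁ ∸ i₂ ≡ (m ∸ j ∸ i₁) + (j ∸ i₂)
m∸i₁∸i₂≡[m∸j∸i₁]+[j∸i₂] m j i₁ i₂ j≤m i₁≤m∸j i₂≤j = begin
  m ∸ i₁ ∸ i₂               ≡⟨ cong (λ x → x ∸ i₁ ∸ i₂) (sym (ℕₚ.m∸n+n≡m j≤m)) ⟩
  m ∸ j + j ∸ i₁ ∸ i₂       ≡⟨ cong (_∸ i₂) (ℕₚ.+-∸-comm j i₁≤m∸j) ⟩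
  m ∸ j ∸ i₁ + j ∸ i₂       ≡⟨ ℕₚ.+-∸-assoc (m ∸ j ∸ i₁) i₂≤j ⟩
  m ∸ j ∸ i₁ + (j ∸ i₂)     ∎

sign-split : ∀ m j i₁ → j ≤ m → i₁ ≤ m ∸ j → sign i₁ *ℤ sign (m ∸ j ∸ i₁) ≡ sign (m + j)
sign-split m j i₁ j≤m i₁≤m∸j = begin
  sign i₁ *ℤ sign (m ∸ j ∸ i₁)  ≡⟨ sym (sign-+ i₁ (m ∸ j ∸ i₁)) ⟩
  sign (i₁ + (m ∸ j ∸ i₁))      ≡⟨ cong sign (ℕₚ.m+[n∸m]≡n i₁≤m∸j) ⟩
  sign (m ∸ j)                  ≡⟨ sym (sign-even (m ∸ j) j) ⟩
  sign (m ∸ j + j + j)          ≡⟨ cong (λ x → sign (x + j)) (ℕₚ.m∸n+n≡m j≤m) ⟩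
  sign (m + j)                  ∎

module BlockSeries (a b s K : ℕ) where

  G⁺ G⁻ G : Series
  G⁺ = linear (+ b) (+ s) ⊛ 1+z ^ K
  G⁻ = linear (- + a) (- + s)
  G  = G⁺ ⊕ G⁻

  G⁺-coefficient : ∀ q → G⁺ q ≡ + b *ℤ shift 1 (1+z ^ K) q +ℤ + s *ℤ (1+z ^ K) q
  G⁺-coefficient q = trans (⊛-distribʳ (1+z ^ K) ((+ b) ·z^ 1) ((+ s) ·z^ 0) q)
                          (cong₂ _+ℤ_ (·z^-⊛ (+ b) 1 (1+z ^ K) q) (·z^-⊛ (+ s) 0 (1+z ^ K) q))

  G⁺^ : ∀ j → G⁺ ^ j ≗ linear (+ b) (+ s) ^ j ⊛ 1+z ^ (K * j)
  G⁺^ j n = trans (^-distrib-* (linear (+ b) (+ s)) (1+z ^ K) j n)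
                 (⊛-congʳ (linear (+ b) (+ s) ^ j) (^-assocʳ 1+z K j) n)

  G⁺^-⊛-G⁻^ : ∀ j u n → (G⁺ ^ j ⊛ G⁻ ^ u) n ≡ ∑[ i₁ ≤ u ] ∑[ i₂ ≤ j ]
    (+ (u C i₁) *ℤ ((- + a) ^ℤ i₁ *ℤ (- + s) ^ℤ (u ∸ i₁) *ℤ
      (+ (j C i₂) *ℤ ((+ b) ^ℤ i₂ *ℤ (+ s) ^ℤ (j ∸ i₂) *ℤ + binomℤ (K * j) (+ n - + (i₁ + i₂))))))
  G⁺^-⊛-G⁻^ j u n = begin
    (G⁺ ^ j ⊛ G⁻ ^ u) n
      ≡⟨ ⊛-comm (G⁺ ^ j) (G⁻ ^ u) n ⟩
    (G⁻ ^ u ⊛ G⁺ ^ j) n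
      ≡⟨ ⊛-congʳ (G⁻ ^ u) (G⁺^ j) n ⟩
    (G⁻ ^ u ⊛ (Lʲ ⊛ B)) n
      ≡⟨ linear^-⊛ (- + a) (- + s) u (Lʲ ⊛ B) n ⟩
    ∑[ i₁ ≤ u ] (+ (u C i₁) *ℤ (X₁ i₁ *ℤ shift i₁ (Lʲ ⊛ B) n))
      ≡⟨ ∑-cong u (λ i₁ _ → inner i₁) ⟩
    ∑[ i₁ ≤ u ] ∑[ i₂ ≤ j ] (+ (u C i₁) *ℤ (X₁ i₁ *ℤ (+ (j C i₂) *ℤ (X₂ i₂ *ℤ + binomℤ (K * j) (+ n - + (i₁ + i₂)))))) ∎
    where
    Lʲ B : Series
    Lʲ = linear (+ b) (+ s) ^ j
    B  = 1+z ^ (K * j)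
    X₁ X₂ : ℕ → ℤ
    X₁ i₁ = (- + a) ^ℤ i₁ *ℤ (- + s) ^ℤ (u ∸ i₁)
    X₂ i₂ = (+ b) ^ℤ i₂ *ℤ (+ s) ^ℤ (j ∸ i₂)
    inner : ∀ i₁ → + (u C i₁) *ℤ (X₁ i₁ *ℤ shift i₁ (Lʲ ⊛ B) n) ≡
      ∑[ i₂ ≤ j ] (+ (u C i₁) *ℤ (X₁ i₁ *ℤ (+ (j C i₂) *ℤ (X₂ i₂ *ℤ + binomℤ (K * j) (+ n - + (i₁ + i₂))))))
    inner i₁ = begin
      + (u C i₁) *ℤ (X₁ i₁ *ℤ shift i₁ (Lʲ ⊛ B) n)
        ≡⟨ cong (λ x → + (u C i₁) *ℤ (X₁ i₁ *ℤ x)) (trans (shift-⊛ i₁ Lʲ B n) (linear^-⊛ (+ b) (+ s) j (shift i₁ B) n)) ⟩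
      + (u C i₁) *ℤ (X₁ i₁ *ℤ ∑[ i₂ ≤ j ] (+ (j C i₂) *ℤ (X₂ i₂ *ℤ shift i₂ (shift i₁ B) n)))
        ≡⟨ cong (λ x → + (u C i₁) *ℤ (X₁ i₁ *ℤ x)) (∑-cong j (λ i₂ _ → cong (λ x → + (j C i₂) *ℤ (X₂ i₂ *ℤ x)) (binomial-term i₂))) ⟩
      + (u C i₁) *ℤ (X₁ i₁ *ℤ ∑[ i₂ ≤ j ] (+ (j C i₂) *ℤ (X₂ i₂ *ℤ + binomℤ (K * j) (+ n - + (i₁ + i₂)))))
        ≡⟨ trans (cong (+ (u C i₁) *ℤ_) (*-distribˡ-∑ j (X₁ i₁) _)) (*-distribˡ-∑ j (+ (u C i₁)) _) ⟩
      ∑[ i₂ ≤ j ] (+ (u C i₁) *ℤ (X₁ i₁ *ℤ (+ (j C i₂) *ℤ (X₂ i₂ *ℤ + binomℤ (K * j) (+ n - + (i₁ + i₂)))))) ∎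
      where
      binomial-term : ∀ i₂ → shift i₂ (shift i₁ B) n ≡ + binomℤ (K * j) (+ n - + (i₁ + i₂))
      binomial-term i₂ = begin
        shift i₂ (shift i₁ B) n
          ≡⟨ shift-+ i₂ i₁ B n ⟩
        shift (i₂ + i₁) B n
          ≡⟨ shift-1+z^ (K * j) (i₂ + i₁) n ⟩
        + binomℤ (K * j) (+ n - + (i₂ + i₁))
          ≡⟨ cong (λ i → + binomℤ (K * j) (+ n - + i)) (ℕₚ.+-comm i₂ i₁) ⟩
        + binomℤ (K * j) (+ n - + (i₁ + i₂)) ∎

  G^-term : ∀ m n j i₁ i₂ → j ≤ m → i₁ ≤ m ∸ j → i₂ ≤ j →
    + (m C j) *ℤ (+ ((m ∸ j) C i₁) *ℤ ((- + a) ^ℤ i₁ *ℤ (- + s) ^ℤ (m ∸ j ∸ i₁) *ℤ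
      (+ (j C i₂) *ℤ ((+ b) ^ℤ i₂ *ℤ (+ s) ^ℤ (j ∸ i₂) *ℤ + binomℤ (K * j) (+ n - + (i₁ + i₂))))))
    ≡ sign (m + j) *ℤ + (s ℕ.^ (m ∸ i₁ ∸ i₂) * a ℕ.^ i₁ * b ℕ.^ i₂ * (m C j) * ((m ∸ j) C i₁) * (j C i₂)
                         * binomℤ (K * j) (+ n - + (i₁ + i₂)))
  G^-term m n j i₁ i₂ j≤m i₁≤m∸j i₂≤j = begin
    Cm *ℤ (Cu *ℤ ((- + a) ^ℤ i₁ *ℤ (- + s) ^ℤ (m ∸ j ∸ i₁) *ℤ (Cj *ℤ ((+ b) ^ℤ i₂ *ℤ (+ s) ^ℤ (j ∸ i₂) *ℤ Bz))))
      ≡⟨ cong₂ (λ x y → Cm *ℤ (Cu *ℤ (x *ℤ (Cj *ℤ (y *ℤ Bz))))) (cong₂ _*ℤ_ (signed a i₁) (signed s (m ∸ j ∸ i₁)))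
                                                                 (sym (cong₂ _*ℤ_ (pos-^ b i₂) (pos-^ s (j ∸ i₂)))) ⟩
    Cm *ℤ (Cu *ℤ (sign i₁ *ℤ A *ℤ (sign (m ∸ j ∸ i₁) *ℤ S₁) *ℤ (Cj *ℤ (Bb *ℤ S₂ *ℤ Bz))))
      ≡⟨ solve 10 (λ σ₁ σ₂ A S₁ Bb S₂ Cm Cu Cj Bz →
                    Cm :* (Cu :* (σ₁ :* A :* (σ₂ :* S₁) :* (Cj :* (Bb :* S₂ :* Bz))))
                    := σ₁ :* σ₂ :* (S₁ :* S₂ :* A :* Bb :* Cm :* Cu :* Cj :* Bz))
               refl (sign i₁) (sign (m ∸ j ∸ i₁)) A S₁ Bb S₂ Cm Cu Cj Bz ⟩
    sign i₁ *ℤ sign (m ∸ j ∸ i₁) *ℤ (S₁ *ℤ S₂ *ℤ A *ℤ Bb *ℤ Cm *ℤ Cu *ℤ Cj *ℤ Bz)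
      ≡⟨ cong₂ _*ℤ_ (sign-split m j i₁ j≤m i₁≤m∸j) (sym product) ⟩
    sign (m + j) *ℤ + (s ℕ.^ (m ∸ i₁ ∸ i₂) * a ℕ.^ i₁ * b ℕ.^ i₂ * (m C j) * ((m ∸ j) C i₁) * (j C i₂)
                       * binomℤ (K * j) (+ n - + (i₁ + i₂))) ∎
    where
    open ℤ-Solver
    A S₁ Bb S₂ Cm Cu Cj Bz : ℤ
    A  = + (a ℕ.^ i₁)
    S₁ = + (s ℕ.^ (m ∸ j ∸ i₁))
    Bb = + (b ℕ.^ i₂)
    S₂ = + (s ℕ.^ (j ∸ i₂))
    Cm = + (m C j)
    Cu = + ((m ∸ j) C i₁)
    Cj = + (j C i₂)
    Bz = + binomℤ (K * j) (+ n - + (i₁ + i₂))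
    signed : ∀ x e → (- + x) ^ℤ e ≡ sign e *ℤ + (x ℕ.^ e)
    signed x e = trans (neg-^ (+ x) e) (cong (sign e *ℤ_) (sym (pos-^ x e)))
    power : + (s ℕ.^ (m ∸ i₁ ∸ i₂)) ≡ S₁ *ℤ S₂
    power = begin
      + (s ℕ.^ (m ∸ i₁ ∸ i₂))
        ≡⟨ cong (λ e → + (s ℕ.^ e)) (m∸i₁∸i₂≡[m∸j∸i₁]+[j∸i₂] m j i₁ i₂ j≤m i₁≤m∸j i₂≤j) ⟩
      + (s ℕ.^ (m ∸ j ∸ i₁ + (j ∸ i₂)))
        ≡⟨ cong +_ (ℕₚ.^-distribˡ-+-* s (m ∸ j ∸ i₁) (j ∸ i₂)) ⟩
      + (s ℕ.^ (m ∸ j ∸ i₁) * s ℕ.^ (j ∸ i₂))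
        ≡⟨ ℤₚ.pos-* (s ℕ.^ (m ∸ j ∸ i₁)) _ ⟩
      S₁ *ℤ S₂ ∎
    product : + (s ℕ.^ (m ∸ i₁ ∸ i₂) * a ℕ.^ i₁ * b ℕ.^ i₂ * (m C j) * ((m ∸ j) C i₁) * (j C i₂)
                 * binomℤ (K * j) (+ n - + (i₁ + i₂))) ≡ S₁ *ℤ S₂ *ℤ A *ℤ Bb *ℤ Cm *ℤ Cu *ℤ Cj *ℤ Bz
    product = pos-*ˡ _ (pos-*ˡ _ (pos-*ˡ _ (pos-*ˡ _ (pos-*ˡ _ (pos-*ˡ _ power)))))

  G^-coefficient : ∀ m n → (G ^ m) n ≡ ∑[ j ≤ m ] ∑[ i₁ ≤ m ∸ j ] ∑[ i₂ ≤ j ]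
    (sign (m + j) *ℤ + (s ℕ.^ (m ∸ i₁ ∸ i₂) * a ℕ.^ i₁ * b ℕ.^ i₂ * (m C j) * ((m ∸ j) C i₁) * (j C i₂)
                        * binomℤ (K * j) (+ n - + (i₁ + i₂))))
  G^-coefficient m n = begin
    (G ^ m) n
      ≡⟨ binomial-coefficient m G⁺ G⁻ n ⟩
    ∑[ j ≤ m ] (+ (m C j) *ℤ (G⁺ ^ j ⊛ G⁻ ^ (m ∸ j)) n)
      ≡⟨ ∑-cong m (λ j j≤m → trans (cong (+ (m C j) *ℤ_) (G⁺^-⊛-G⁻^ j (m ∸ j) n))
           (trans (*-distribˡ-∑ (m ∸ j) (+ (m C j)) _)
             (∑-cong (m ∸ j) (λ i₁ i₁≤m∸j → trans (*-distribˡ-∑ j (+ (m C j)) _)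
               (∑-cong j (λ i₂ i₂≤j → G^-term m n j i₁ i₂ j≤m i₁≤m∸j i₂≤j)))))) ⟩
    ∑[ j ≤ m ] ∑[ i₁ ≤ m ∸ j ] ∑[ i₂ ≤ j ]
      (sign (m + j) *ℤ + (s ℕ.^ (m ∸ i₁ ∸ i₂) * a ℕ.^ i₁ * b ℕ.^ i₂ * (m C j) * ((m ∸ j) C i₁) * (j C i₂)
                          * binomℤ (K * j) (+ n - + (i₁ + i₂)))) ∎

-- Descents from a residue class

applyUpTo-+ : ∀ {A : Set} (f : ℕ → A) m n → applyUpTo f (m + n) ≡ applyUpTo f m ++ applyUpTo (λ i → f (m + i)) n
applyUpTo-+ f zero    n = refl
applyUpTo-+ f (suc m) n = cong (f 0 ∷_) (applyUpTo-+ (f ∘ suc) m n)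

∑-applyUpTo-1 : ∀ (f : ℕ → ℕ) c → ∑[ x ← applyUpTo f c ] 1ℤ ≡ + c
∑-applyUpTo-1 f zero    = refl
∑-applyUpTo-1 f (suc c) = trans (cong (1ℤ +ℤ_) (∑-applyUpTo-1 (f ∘ suc) c)) (sym (ℤₚ.pos-+ 1 c))

∑-below : ∀ (f : ℕ → ℤ) {c N} → c ≤ N →
  ∑[ y ← applyUpTo suc N ] (ι (y <ᵇ suc c) *ℤ f y) ≡ ∑ₗ f (applyUpTo suc c)
∑-below f {c} {N} c≤N = begin
  ∑ₗ g (applyUpTo suc N)
    ≡⟨ cong (∑ₗ g) (trans (cong (applyUpTo suc) (sym (ℕₚ.m+[n∸m]≡n c≤N))) (applyUpTo-+ suc c (N ∸ c))) ⟩
  ∑ₗ g (applyUpTo suc c ++ applyUpTo (λ i → suc (c + i)) (N ∸ c))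
    ≡⟨ ∑ₗ-++ g (applyUpTo suc c) _ ⟩
  ∑ₗ g (applyUpTo suc c) +ℤ ∑ₗ g (applyUpTo (λ i → suc (c + i)) (N ∸ c))
    ≡⟨ cong₂ _+ℤ_ (∑ₗ-cong (applyUpTo suc c) below) (trans (∑ₗ-cong (applyUpTo _ (N ∸ c)) above) (∑ₗ-zero (applyUpTo (λ i → suc (c + i)) (N ∸ c)))) ⟩
  ∑ₗ f (applyUpTo suc c) +ℤ 0ℤ
    ≡⟨ ℤₚ.+-identityʳ _ ⟩
  ∑ₗ f (applyUpTo suc c) ∎
  where
  g : ℕ → ℤ
  g y = ι (y <ᵇ suc c) *ℤ f y
  below : ∀ y → y ∈ applyUpTo suc c → g y ≡ f y
  below y y∈ with ∈-applyUpTo⁻ suc y∈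
  ... | i , i<c , refl = trans (cong (λ x → ι x *ℤ f (suc i)) (dec-true (suc i <? suc c) (s≤s i<c))) (ℤₚ.*-identityˡ _)
  above : ∀ y → y ∈ applyUpTo (λ i → suc (c + i)) (N ∸ c) → g y ≡ 0ℤ
  above y y∈ with ∈-applyUpTo⁻ (λ i → suc (c + i)) y∈
  ... | i , _ , refl = cong (λ x → ι x *ℤ f (suc (c + i)))
                            (dec-false (suc (c + i) <? suc c) (ℕₚ.≤⇒≯ (s≤s (ℕₚ.m≤m+n c i))))

ι-∧ : ∀ x y → ι (x ∧ y) ≡ ι y *ℤ ι x
ι-∧ true  true  = refl
ι-∧ true  false = refl
ι-∧ false true  = refl
ι-∧ false false = refl

first-coefficient-identity : ∀ s k t r → t ≤ s → 1 ≤ r → r ∸ 1 + s * suc k ≡ s * k + t + (s ∸ t + r ∸ 1)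
first-coefficient-identity s k t (suc r) t≤s _ with ℕₚ.m≤n⇒∃[o]m+o≡n t≤s
... | d , refl = begin
  r + (t + d) * suc k
    ≡⟨ solve 4 (λ r t d k → r :+ (t :+ d) :* (con 1 :+ k) := (t :+ d) :* k :+ t :+ (d :+ r)) refl r t d k ⟩
  (t + d) * k + t + (d + r)
    ≡⟨ cong (λ x → (t + d) * k + t + x) (sym (cong (_∸ 1) (ℕₚ.+-suc d r))) ⟩
  (t + d) * k + t + (d + suc r ∸ 1)
    ≡⟨ cong (λ x → (t + d) * k + t + (x + suc r ∸ 1)) (sym (ℕₚ.m+n∸m≡n t d)) ⟩
  (t + d) * k + t + (t + d ∸ t + suc r ∸ 1) ∎
  where open ℕ-Solver

inR-residue : ∀ s .{{_ : NonZero s}} {c} q u → c < s → u < s → inR s c (u + q * s) ≡ (u ≡ᵇ c)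
inR-residue s q u c<s u<s = cong₂ _≡ᵇ_ (trans ([m+kn]%n≡m%n u q s) (m<n⇒m%n≡m u<s)) (m<n⇒m%n≡m c<s)

inR⇒≡ : ∀ s .{{_ : NonZero s}} {c} x → c < s → inR s c x ≡ true → x ≡ c + (x / s) * s
inR⇒≡ s {c} x c<s x∈R = trans (m≡m%n+[m/n]*n x s)
  (cong (_+ (x / s) * s) (trans (ℕₚ.≡ᵇ⇒≡ (x % s) (c % s) (subst T (sym x∈R) _)) (m<n⇒m%n≡m c<s)))

module ResidueCount (s r : ℕ) .{{_ : NonZero s}} (1≤r : 1 ≤ r) (r<s : r < s) where

  residueCount : ℕ → ℕ
  residueCount zero    = 0
  residueCount (suc c) = (if inR s r (suc c) then 1 else 0) + residueCount c

  residueCount-below : ∀ q u → u < r → residueCount (u + q * s) ≡ q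
  residueCount-above : ∀ q u → r ≤ u → u < s → residueCount (u + q * s) ≡ suc q

  residueCount-below zero    zero    _   = refl
  residueCount-below (suc q) zero    _   = begin
    residueCount (s + q * s)
      ≡⟨ cong (λ x → residueCount (x + q * s)) (sym (ℕₚ.suc-pred s)) ⟩
    (if inR s r (suc (ℕ.pred s) + q * s) then 1 else 0) + residueCount (ℕ.pred s + q * s)
      ≡⟨ cong₂ (λ x y → (if x then 1 else 0) + y) s+qs∉R (residueCount-above q (ℕ.pred s) r≤pred[s] pred[s]<s) ⟩
    suc q ∎
    where
    pred[s]<s : ℕ.pred s < s
    pred[s]<s = ℕₚ.≤-reflexive (ℕₚ.suc-pred s)
    r≤pred[s] : r ≤ ℕ.pred s
    r≤pred[s] = ℕₚ.≤-pred (ℕₚ.≤-trans r<s (ℕₚ.≤-reflexive (sym (ℕₚ.suc-pred s))))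
    s+qs∉R : inR s r (suc (ℕ.pred s) + q * s) ≡ false
    s+qs∉R = trans (cong (λ x → inR s r (x + q * s)) (ℕₚ.suc-pred s))
                   (trans (inR-residue s (suc q) 0 r<s (ℕₚ.≤-trans (s≤s z≤n) pred[s]<s)) (dec-false (0 ≟ r) (ℕₚ.<⇒≢ 1≤r)))
  residueCount-below q       (suc u) u<r = cong₂ (λ x y → (if x then 1 else 0) + y)
    (trans (inR-residue s q (suc u) r<s (ℕₚ.<-trans u<r r<s)) (dec-false (suc u ≟ r) (ℕₚ.<⇒≢ u<r)))
    (residueCount-below q u (ℕₚ.<-trans (ℕₚ.n<1+n u) u<r))

  residueCount-above q zero    r≤0   _     = contradiction (ℕₚ.≤-trans 1≤r r≤0) λ ()
  residueCount-above q (suc u) r≤1+u 1+u<s with ℕₚ.m≤n⇒m<n∨m≡n r≤1+u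
  ... | inj₁ (s≤s r≤u) = cong₂ (λ x y → (if x then 1 else 0) + y)
    (trans (inR-residue s q (suc u) r<s 1+u<s) (dec-false (suc u ≟ r) (ℕₚ.>⇒≢ (s≤s r≤u))))
    (residueCount-above q u r≤u (ℕₚ.<-trans (ℕₚ.n<1+n u) 1+u<s))
  ... | inj₂ r≡1+u = cong₂ (λ x y → (if x then 1 else 0) + y)
    (trans (inR-residue s q (suc u) r<s 1+u<s) (dec-true (suc u ≟ r) (sym r≡1+u)))
    (residueCount-below q u (ℕₚ.≤-reflexive (sym r≡1+u)))

  1+[r∸1]≡r : suc (r ∸ 1) ≡ r
  1+[r∸1]≡r = trans (ℕₚ.+-comm 1 (r ∸ 1)) (ℕₚ.m∸n+n≡m 1≤r)

  ∈R⇒≡r∸1+residueCount*s : ∀ c → inR s r (suc c) ≡ true → c ≡ r ∸ 1 + residueCount c * s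
  ∈R⇒≡r∸1+residueCount*s c 1+c∈R = begin
    c                                ≡⟨ c≡r∸1+qs ⟩
    r ∸ 1 + q * s                    ≡⟨ cong (λ x → r ∸ 1 + x * s) (sym (trans (cong residueCount c≡r∸1+qs)
                                                                       (residueCount-below q (r ∸ 1) (ℕₚ.≤-reflexive 1+[r∸1]≡r)))) ⟩
    r ∸ 1 + residueCount c * s       ∎
    where
    q : ℕ
    q = suc c / s
    c≡r∸1+qs : c ≡ r ∸ 1 + q * s
    c≡r∸1+qs = ℕₚ.suc-injective (trans (inR⇒≡ s (suc c) r<s 1+c∈R) (cong (_+ q * s) (sym 1+[r∸1]≡r)))

module DescentBlocks (s k t r : ℕ) .{{_ : NonZero s}} (t<s : t < s) (1≤r : 1 ≤ r) (r≤t : r ≤ t) where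

  N a b K : ℕ
  N = s * k + t
  a = s ∸ t + r ∸ 1
  b = r ∸ 1
  K = suc k

  descent : ℕ → ℕ → Bool
  descent x y = (y <ᵇ x) ∧ inR s r x

  r<s : r < s
  r<s = ℕₚ.≤-<-trans r≤t t<s

  open LinkStatistics N descent public
  open BlockSeries a b s K public using (G⁺; G; G⁺-coefficient)
  open ResidueCount s r 1≤r r<s

  residueCount-N : residueCount N ≡ K
  residueCount-N = trans (cong residueCount (trans (ℕₚ.+-comm (s * k) t) (cong (λ x → t + x) (ℕₚ.*-comm s k))))
                         (residueCount-above k t r≤t t<s)

  prefix : ℕ → ℕ → ℤ
  prefix ℓ c = ∑[ x ← applyUpTo suc c ] chains x ℓ

  prefix-suc : ∀ ℓ c → prefix ℓ (suc c) ≡ prefix ℓ c +ℤ chains (suc c) ℓ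
  prefix-suc ℓ c = begin
    ∑ₗ f (applyUpTo suc (suc c))                  ≡⟨ cong (∑ₗ f) (sym (Listₚ.applyUpTo-∷ʳ suc c)) ⟩
    ∑ₗ f (applyUpTo suc c ++ suc c ∷ [])          ≡⟨ ∑ₗ-++ f (applyUpTo suc c) _ ⟩
    prefix ℓ c +ℤ (chains (suc c) ℓ +ℤ 0ℤ)        ≡⟨ cong (prefix ℓ c +ℤ_) (ℤₚ.+-identityʳ _) ⟩
    prefix ℓ c +ℤ chains (suc c) ℓ                ∎
    where
    f : ℕ → ℤ
    f x = chains x ℓ

  chains-suc : ∀ ℓ c → c < N → chains (suc c) (suc ℓ) ≡ ι (inR s r (suc c)) *ℤ prefix ℓ c
  chains-suc ℓ c c<N = begin
    ∑[ y ← letters N ] (ι ((y <ᵇ suc c) ∧ inR s r (suc c)) *ℤ chains y ℓ)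
      ≡⟨ ∑ₗ-cong (letters N) (λ y _ → trans (cong (_*ℤ chains y ℓ) (ι-∧ (y <ᵇ suc c) (inR s r (suc c))))
                                                (ℤₚ.*-assoc (ι (inR s r (suc c))) (ι (y <ᵇ suc c)) (chains y ℓ))) ⟩
    ∑[ y ← letters N ] (ι (inR s r (suc c)) *ℤ (ι (y <ᵇ suc c) *ℤ chains y ℓ))
      ≡⟨ sym (*-distribˡ-∑ₗ (ι (inR s r (suc c))) _ (letters N)) ⟩
    ι (inR s r (suc c)) *ℤ ∑[ y ← letters N ] (ι (y <ᵇ suc c) *ℤ chains y ℓ)
      ≡⟨ cong (λ ys → ι (inR s r (suc c)) *ℤ ∑[ y ← ys ] (ι (y <ᵇ suc c) *ℤ chains y ℓ)) (letters≡applyUpTo N) ⟩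
    ι (inR s r (suc c)) *ℤ ∑[ y ← applyUpTo suc N ] (ι (y <ᵇ suc c) *ℤ chains y ℓ)
      ≡⟨ cong (ι (inR s r (suc c)) *ℤ_) (∑-below (λ y → chains y ℓ) (ℕₚ.<⇒≤ c<N)) ⟩
    ι (inR s r (suc c)) *ℤ prefix ℓ c ∎

  prefixValue : ℕ → ℕ → ℤ
  prefixValue j ℓ = + (b * (j C ℓ) + s * (j C suc ℓ))

  prefixValue-pascal : ∀ j ℓ → prefixValue j (suc ℓ) +ℤ prefixValue j ℓ ≡ prefixValue (suc j) (suc ℓ)
  prefixValue-pascal j ℓ = begin
    + (b * (j C suc ℓ) + s * (j C suc (suc ℓ))) +ℤ + (b * (j C ℓ) + s * (j C suc ℓ))
      ≡⟨ sym (ℤₚ.pos-+ (b * (j C suc ℓ) + s * (j C suc (suc ℓ))) (b * (j C ℓ) + s * (j C suc ℓ))) ⟩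
    + (b * (j C suc ℓ) + s * (j C suc (suc ℓ)) + (b * (j C ℓ) + s * (j C suc ℓ)))
      ≡⟨ cong +_ (solve 6 (λ b s x y z w → b :* y :+ s :* z :+ (b :* x :+ s :* w) := b :* (x :+ y) :+ s :* (w :+ z))
                   refl b s (j C ℓ) (j C suc ℓ) (j C suc (suc ℓ)) (j C suc ℓ)) ⟩
    + (b * (j C ℓ + j C suc ℓ) + s * (j C suc ℓ + j C suc (suc ℓ)))
      ≡⟨ cong₂ (λ x y → + (b * x + s * y)) (nCk+nC[k+1]≡[n+1]C[k+1] j ℓ) (nCk+nC[k+1]≡[n+1]C[k+1] j (suc ℓ)) ⟩
    prefixValue (suc j) (suc ℓ) ∎
    where open ℕ-Solver

  prefix-zero : ∀ c → prefix 0 c ≡ + c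
  prefix-zero = ∑-applyUpTo-1 suc

  prefix-closed : ∀ ℓ c → c ≤ N → prefix (suc ℓ) c ≡ prefixValue (residueCount c) (suc ℓ)
  prefix-at-R   : ∀ ℓ c → c < N → inR s r (suc c) ≡ true → prefix ℓ c ≡ prefixValue (residueCount c) ℓ

  prefix-closed ℓ zero    _     = cong +_ (cong₂ _+_ (sym (ℕₚ.*-zeroʳ b)) (sym (ℕₚ.*-zeroʳ s)))
  prefix-closed ℓ (suc c) 1+c≤N = begin
    prefix (suc ℓ) (suc c)                                                 ≡⟨ prefix-suc (suc ℓ) c ⟩
    prefix (suc ℓ) c +ℤ chains (suc c) (suc ℓ)                             ≡⟨ cong₂ _+ℤ_ (prefix-closed ℓ c (ℕₚ.<⇒≤ 1+c≤N))
                                                                                          (chains-suc ℓ c 1+c≤N) ⟩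
    prefixValue (residueCount c) (suc ℓ) +ℤ ι (inR s r (suc c)) *ℤ prefix ℓ c ≡⟨ next-letter (inR s r (suc c)) refl ⟩
    prefixValue (residueCount (suc c)) (suc ℓ)                             ∎
    where
    next-letter : ∀ x → inR s r (suc c) ≡ x → prefixValue (residueCount c) (suc ℓ) +ℤ ι x *ℤ prefix ℓ c
                                              ≡ prefixValue ((if x then 1 else 0) + residueCount c) (suc ℓ)
    next-letter true  1+c∈R = trans (cong (prefixValue (residueCount c) (suc ℓ) +ℤ_)
                                         (trans (ℤₚ.*-identityˡ (prefix ℓ c)) (prefix-at-R ℓ c 1+c≤N 1+c∈R)))
                                   (prefixValue-pascal (residueCount c) ℓ)
    next-letter false _     = ℤₚ.+-identityʳ _

  prefix-at-R zero    c _   1+c∈R = begin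
    prefix 0 c                        ≡⟨ prefix-zero c ⟩
    + c                               ≡⟨ cong +_ (∈R⇒≡r∸1+residueCount*s c 1+c∈R) ⟩
    + (b + residueCount c * s)        ≡⟨ cong +_ (cong₂ _+_ (sym (ℕₚ.*-identityʳ b))
                                           (trans (ℕₚ.*-comm (residueCount c) s) (cong (s *_) (sym (nC1≡n (residueCount c)))))) ⟩
    prefixValue (residueCount c) 0    ∎
  prefix-at-R (suc ℓ) c c<N _   = prefix-closed ℓ c (ℕₚ.<⇒≤ c<N)

  blocks-suc : ∀ ℓ → blocks (suc ℓ) ≡ prefix ℓ N
  blocks-suc ℓ = cong (∑ₗ (λ x → chains x ℓ)) (letters≡applyUpTo N)

  blocks-closed : blocks ≗ G
  blocks-closed zero = sym (begin
    G⁺ 0 +ℤ (0ℤ +ℤ - + s)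
      ≡⟨ cong (_+ℤ (0ℤ +ℤ - + s)) (G⁺-coefficient 0) ⟩
    + b *ℤ 0ℤ +ℤ + s *ℤ (1+z ^ K) 0 +ℤ (0ℤ +ℤ - + s)
      ≡⟨ cong (λ x → + b *ℤ 0ℤ +ℤ + s *ℤ x +ℤ (0ℤ +ℤ - + s)) (1+z^-coefficient K 0) ⟩
    + b *ℤ 0ℤ +ℤ + s *ℤ 1ℤ +ℤ (0ℤ +ℤ - + s)
      ≡⟨ solve 2 (λ b s → b :* con 0ℤ :+ s :* con 1ℤ :+ (con 0ℤ :+ :- s) := con 0ℤ) refl (+ b) (+ s) ⟩
    0ℤ ∎)
    where open ℤ-Solver
  blocks-closed (suc zero) = sym (begin
    G⁺ 1 +ℤ (- + a +ℤ 0ℤ)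
      ≡⟨ cong (_+ℤ (- + a +ℤ 0ℤ)) (G⁺-coefficient 1) ⟩
    + b *ℤ (1+z ^ K) 0 +ℤ + s *ℤ (1+z ^ K) 1 +ℤ (- + a +ℤ 0ℤ)
      ≡⟨ cong₂ (λ x y → + b *ℤ x +ℤ + s *ℤ y +ℤ (- + a +ℤ 0ℤ)) (1+z^-coefficient K 0) (trans (1+z^-coefficient K 1) (cong +_ (nC1≡n K))) ⟩
    + b *ℤ 1ℤ +ℤ + s *ℤ + K +ℤ (- + a +ℤ 0ℤ)
      ≡⟨ solve 4 (λ b s K a → b :* con 1ℤ :+ s :* K :+ (:- a :+ con 0ℤ) := b :+ s :* K :- a) refl (+ b) (+ s) (+ K) (+ a) ⟩
    + b +ℤ + s *ℤ + K - + a
      ≡⟨ cong (λ x → + b +ℤ x - + a) (sym (ℤₚ.pos-* s K)) ⟩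
    + b +ℤ + (s * K) - + a
      ≡⟨ cong (_- + a) (sym (ℤₚ.pos-+ b (s * K))) ⟩
    + (b + s * K) - + a
      ≡⟨ cong (λ x → + x - + a) (first-coefficient-identity s k t r (ℕₚ.<⇒≤ t<s) 1≤r) ⟩
    + (N + a) - + a
      ≡⟨ cong (_- + a) (ℤₚ.pos-+ N a) ⟩
    + N +ℤ + a - + a
      ≡⟨ solve 2 (λ N a → N :+ a :- a := N) refl (+ N) (+ a) ⟩
    + N
      ≡⟨ sym (trans (blocks-suc 0) (prefix-zero N)) ⟩
    blocks 1 ∎)
    where open ℤ-Solver
  blocks-closed (suc (suc ℓ)) = sym (begin
    G⁺ (suc (suc ℓ)) +ℤ (0ℤ +ℤ 0ℤ)
      ≡⟨ ℤₚ.+-identityʳ _ ⟩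
    G⁺ (suc (suc ℓ))
      ≡⟨ G⁺-coefficient (suc (suc ℓ)) ⟩
    + b *ℤ (1+z ^ K) (suc ℓ) +ℤ + s *ℤ (1+z ^ K) (suc (suc ℓ))
      ≡⟨ cong₂ (λ x y → + b *ℤ x +ℤ + s *ℤ y) (1+z^-coefficient K (suc ℓ)) (1+z^-coefficient K (suc (suc ℓ))) ⟩
    + b *ℤ + (K C suc ℓ) +ℤ + s *ℤ + (K C suc (suc ℓ))
      ≡⟨ sym (trans (ℤₚ.pos-+ (b * (K C suc ℓ)) _) (cong₂ _+ℤ_ (ℤₚ.pos-* b _) (ℤₚ.pos-* s _))) ⟩
    prefixValue K (suc ℓ)
      ≡⟨ cong (λ j → prefixValue j (suc ℓ)) (sym residueCount-N) ⟩
    prefixValue (residueCount N) (suc ℓ)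
      ≡⟨ sym (trans (blocks-suc (suc ℓ)) (prefix-closed ℓ N ℕₚ.≤-refl)) ⟩
    blocks (suc (suc ℓ)) ∎)

-- Rises from a residue class, through the complement

module Complement (s k t : ℕ) .{{_ : NonZero s}} (t<s : t < s) where

  N : ℕ
  N = s * k + t

  ≤N⇒≤k : ∀ c q → c + q * s ≤ N → q ≤ k
  ≤N⇒≤k c q c+qs≤N = ℕₚ.≤-pred (ℕₚ.*-cancelʳ-< s q (suc k) (ℕₚ.≤-<-trans (ℕₚ.≤-trans (ℕₚ.m≤n+m (q * s) c) c+qs≤N) N<[1+k]s))
    where
    N<[1+k]s : N < suc k * s
    N<[1+k]s = ℕₚ.<-≤-trans (ℕₚ.+-monoʳ-< (s * k) t<s) (ℕₚ.≤-reflexive (trans (ℕₚ.+-comm (s * k) s) (cong (λ x → s + x) (ℕₚ.*-comm s k))))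

  complement-residue : ∀ {c c′} q → c + c′ ≡ suc t → c + q * s ≤ N → complement N (c + q * s) ≡ c′ + (k ∸ q) * s
  complement-residue {c} {c′} q c+c′≡1+t c+qs≤N = begin
    suc N ∸ (c + q * s)                ≡⟨ cong (_∸ (c + q * s)) 1+N≡ ⟩
    c + (c′ + k * s) ∸ (c + q * s)     ≡⟨ ℕₚ.[m+n]∸[m+o]≡n∸o c (c′ + k * s) (q * s) ⟩
    c′ + k * s ∸ q * s                 ≡⟨ ℕₚ.+-∸-assoc c′ (ℕₚ.*-monoˡ-≤ s (≤N⇒≤k c q c+qs≤N)) ⟩
    c′ + (k * s ∸ q * s)               ≡⟨ cong (λ x → c′ + x) (sym (ℕₚ.*-distribʳ-∸ s k q)) ⟩
    c′ + (k ∸ q) * s                   ∎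
    where
    1+N≡ : suc N ≡ c + (c′ + k * s)
    1+N≡ = begin
      suc (s * k + t)      ≡⟨ cong suc (trans (ℕₚ.+-comm (s * k) t) (cong (λ x → t + x) (ℕₚ.*-comm s k))) ⟩
      suc t + k * s        ≡⟨ cong (_+ k * s) (sym c+c′≡1+t) ⟩
      c + c′ + k * s       ≡⟨ ℕₚ.+-assoc c c′ (k * s) ⟩
      c + (c′ + k * s)     ∎

  complement-∈R : ∀ {c c′ x} → c + c′ ≡ suc t → c < s → c′ < s → x ≤ N →
    inR s c x ≡ true → inR s c′ (complement N x) ≡ true
  complement-∈R {c} {c′} {x} c+c′≡1+t c<s c′<s x≤N x∈R = begin
    inR s c′ (complement N x)
      ≡⟨ cong (inR s c′ ∘ complement N) x≡ ⟩
    inR s c′ (complement N (c + x / s * s))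
      ≡⟨ cong (inR s c′) (complement-residue (x / s) c+c′≡1+t (subst (_≤ N) x≡ x≤N)) ⟩
    inR s c′ (c′ + (k ∸ x / s) * s)
      ≡⟨ inR-residue s (k ∸ x / s) c′ c′<s c′<s ⟩
    c′ ≡ᵇ c′
      ≡⟨ dec-true (c′ ≟ c′) refl ⟩
    true ∎
    where
    x≡ : x ≡ c + x / s * s
    x≡ = inR⇒≡ s x c<s x∈R

  module _ {r} (1≤r : 1 ≤ r) (r≤t : r ≤ t) where

    r′ : ℕ
    r′ = t + 1 ∸ r

    r+r′≡1+t : r + r′ ≡ suc t
    r+r′≡1+t = trans (ℕₚ.m+[n∸m]≡n (ℕₚ.≤-trans r≤t (ℕₚ.m≤m+n t 1))) (ℕₚ.+-comm t 1)

    r<s : r < s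
    r<s = ℕₚ.≤-<-trans r≤t t<s

    r′<s : r′ < s
    r′<s = ℕₚ.≤-<-trans (ℕₚ.∸-monoʳ-≤ (t + 1) 1≤r) (subst (_< s) (sym (ℕₚ.m+n∸n≡m t 1)) t<s)

    inR-complement : ∀ {x} → x ∈ letters N → inR s r′ x ≡ inR s r (complement N x)
    inR-complement {x} x∈ = ⇔→≡ {z = true} (mk⇔
      (complement-∈R (trans (ℕₚ.+-comm r′ r) r+r′≡1+t) r′<s r<s x≤N)
      (λ cx∈R → subst (λ y → inR s r′ y ≡ true) (complement-involutive N (ℕₚ.m≤n⇒m≤1+n x≤N))
                      (complement-∈R r+r′≡1+t r<s r′<s (ℕₚ.∸-monoʳ-≤ (suc N) 1≤x) cx∈R)))
      where
      1≤x : 1 ≤ x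
      1≤x = proj₁ (∈-letters {N} x∈)
      x≤N : x ≤ N
      x≤N = proj₂ (∈-letters {N} x∈)

    risR≡desR∘complement : ∀ {n π} → π ∈ words N n → risR s r′ π ≡ desR s r (map (complement N) π)
    risR≡desR∘complement {n} {π} π∈ = begin
      risR s r′ π
        ≡⟨ risR≡links s r′ π ⟩
      links (λ x y → (x <ᵇ y) ∧ inR s r′ x) π
        ≡⟨ links-map (complement N) rise≡descent (proj₂ (∈-words {N} {n} π∈)) ⟩
      links (λ x y → (y <ᵇ x) ∧ inR s r x) (map (complement N) π)
        ≡⟨ sym (desR≡links s r (map (complement N) π)) ⟩
      desR s r (map (complement N) π) ∎
      where
      rise≡descent : ∀ {x y} → x ∈ letters N → y ∈ letters N →
        ((x <ᵇ y) ∧ inR s r′ x) ≡ ((complement N y <ᵇ complement N x) ∧ inR s r (complement N x))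
      rise≡descent x∈ y∈ = cong₂ _∧_ (complement-<ᵇ N (ℕₚ.m≤n⇒m≤1+n (proj₂ (∈-letters {N} y∈)))) (inR-complement x∈)

    rises≡descents : ∀ n p → ∑[ π ← words N n ] δ (risR s r′ π) p ≡ ∑[ π ← words N n ] δ (desR s r π) p
    rises≡descents n p = trans (∑ₗ-cong (words N n) (λ π π∈ → cong (λ d → δ d p) (risR≡desR∘complement {n} π∈)))
                               (∑-words-complement N n (λ π → δ (desR s r π) p))

-- The closed formula

n∸m+p+[m+j]≡n+p+j : ∀ n p m j → m ≤ n → n ∸ m + p + (m + j) ≡ n + p + j
n∸m+p+[m+j]≡n+p+j n p m j m≤n = begin
  n ∸ m + p + (m + j)   ≡⟨ solve 4 (λ d p m j → d :+ p :+ (m :+ j) := d :+ m :+ p :+ j) refl (n ∸ m) p m j ⟩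
  n ∸ m + m + p + j     ≡⟨ cong (λ x → x + p + j) (ℕₚ.m∸n+n≡m m≤n) ⟩
  n + p + j             ∎
  where open ℕ-Solver

formula-term : ∀ n p m j X → m ≤ n →
  sign (n + p + j) *ℤ + (X * ((n ∸ m) C p)) ≡ pascal⁻¹ (n ∸ m) p *ℤ (sign (m + j) *ℤ + X)
formula-term n p m j X m≤n = sym (begin
  sign (n ∸ m + p) *ℤ + ((n ∸ m) C p) *ℤ (sign (m + j) *ℤ + X)
    ≡⟨ solve 4 (λ σ c τ x → σ :* c :* (τ :* x) := σ :* τ :* (x :* c))
               refl (sign (n ∸ m + p)) (+ ((n ∸ m) C p)) (sign (m + j)) (+ X) ⟩
  sign (n ∸ m + p) *ℤ sign (m + j) *ℤ (+ X *ℤ + ((n ∸ m) C p))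
    ≡⟨ cong₂ _*ℤ_ (sym (sign-+ (n ∸ m + p) (m + j))) (sym (ℤₚ.pos-* X ((n ∸ m) C p))) ⟩
  sign (n ∸ m + p + (m + j)) *ℤ + (X * ((n ∸ m) C p))
    ≡⟨ cong (λ e → sign e *ℤ + (X * ((n ∸ m) C p))) (n∸m+p+[m+j]≡n+p+j n p m j m≤n) ⟩
  sign (n + p + j) *ℤ + (X * ((n ∸ m) C p)) ∎)
  where open ℤ-Solver

formula-expansion : ∀ s k t r n p → formula s k t r n p ≡
  ∑[ m ≤ n ] (pascal⁻¹ (n ∸ m) p *ℤ (BlockSeries.G (s ∸ t + r ∸ 1) (r ∸ 1) s (suc k) ^ m) n)
formula-expansion s k t r n p = begin
  formula s k t r n p
    ≡⟨ trans (Σℤ≡∑ n _) (∑-cong n (λ m _ → trans (Σℤ≡∑ m _) (∑-cong m (λ j _ → trans (Σℤ≡∑ (m ∸ j) _)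
         (∑-cong (m ∸ j) (λ i₁ _ → Σℤ≡∑ j _)))))) ⟩
  ∑[ m ≤ n ] ∑[ j ≤ m ] ∑[ i₁ ≤ m ∸ j ] ∑[ i₂ ≤ j ] (sign (n + p + j) *ℤ + (X (k * j + j) m j i₁ i₂ * ((n ∸ m) C p)))
    ≡⟨ ∑-cong n (λ m m≤n → ∑-cong m (λ j _ → ∑-cong (m ∸ j) (λ i₁ _ → ∑-cong j (λ i₂ _ →
         trans (formula-term n p m j _ m≤n)
               (cong (λ L → pascal⁻¹ (n ∸ m) p *ℤ (sign (m + j) *ℤ + X L m j i₁ i₂)) (ℕₚ.+-comm (k * j) j)))))) ⟩
  ∑[ m ≤ n ] ∑[ j ≤ m ] ∑[ i₁ ≤ m ∸ j ] ∑[ i₂ ≤ j ] (pascal⁻¹ (n ∸ m) p *ℤ (sign (m + j) *ℤ + X (suc k * j) m j i₁ i₂))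
    ≡⟨ ∑-cong n (λ m _ → sym (trans (*-distribˡ-∑ m (pascal⁻¹ (n ∸ m) p) _)
         (∑-cong m (λ j _ → trans (*-distribˡ-∑ (m ∸ j) (pascal⁻¹ (n ∸ m) p) _)
           (∑-cong (m ∸ j) (λ i₁ _ → *-distribˡ-∑ j (pascal⁻¹ (n ∸ m) p) _)))))) ⟩
  ∑[ m ≤ n ] (pascal⁻¹ (n ∸ m) p *ℤ ∑[ j ≤ m ] ∑[ i₁ ≤ m ∸ j ] ∑[ i₂ ≤ j ] (sign (m + j) *ℤ + X (suc k * j) m j i₁ i₂))
    ≡⟨ ∑-cong n (λ m _ → cong (pascal⁻¹ (n ∸ m) p *ℤ_) (sym (BlockSeries.G^-coefficient a b s (suc k) m n))) ⟩
  ∑[ m ≤ n ] (pascal⁻¹ (n ∸ m) p *ℤ (BlockSeries.G a b s (suc k) ^ m) n) ∎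
  where
  a b : ℕ
  a = s ∸ t + r ∸ 1
  b = r ∸ 1
  X : ℕ → ℕ → ℕ → ℕ → ℕ → ℕ
  X L m j i₁ i₂ = s ℕ.^ (m ∸ i₁ ∸ i₂) * a ℕ.^ i₁ * b ℕ.^ i₂ * (m C j) * ((m ∸ j) C i₁) * (j C i₂)
                  * binomℤ L (+ n ℤ.- + (i₁ + i₂))

theorem5p6 : (s k t r n p : ℕ) .{{_ : NonZero s}} → s ≥ 2 → 1 ≤ t → t ≤ s ∸ 1 → 1 ≤ r → r ≤ t →
    (+ countWords (s * k + t) n (desR s r) p ≡ formula s k t r n p)
    × (+ countWords (s * k + t) n (risR s (t + 1 ∸ r)) p ≡ formula s k t r n p)
-- The hypotheses s ≥ 2 and 1 ≤ t follow from 1 ≤ r ≤ t ≤ s ∸ 1.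
theorem5p6 s k t r n p _ _ t≤s∸1 1≤r r≤t = descents , trans rises≡descents descents
  where
  t<s : t < s
  t<s = ℕₚ.m≤pred[n]⇒suc[m]≤n t≤s∸1
  open DescentBlocks s k t r t<s 1≤r r≤t
  descents : + countWords N n (desR s r) p ≡ formula s k t r n p
  descents = begin
    + countWords N n (desR s r) p
      ≡⟨ countWords-∑ N n (desR s r) p ⟩
    ∑[ π ← words N n ] δ (desR s r π) p
      ≡⟨ ∑ₗ-cong (words N n) (λ π _ → cong (λ d → δ d p) (desR≡links s r π)) ⟩
    ∑[ π ← words N n ] δ (links descent π) p
      ≡⟨ links-distribution n p ⟩
    ∑[ m ≤ n ] (pascal⁻¹ (n ∸ m) p *ℤ (blocks ^ m) n)
      ≡⟨ ∑-cong n (λ m _ → cong (pascal⁻¹ (n ∸ m) p *ℤ_) (^-congˡ m blocks-closed n)) ⟩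
    ∑[ m ≤ n ] (pascal⁻¹ (n ∸ m) p *ℤ (G ^ m) n)
      ≡⟨ sym (formula-expansion s k t r n p) ⟩
    formula s k t r n p ∎
  rises≡descents : + countWords N n (risR s (t + 1 ∸ r)) p ≡ + countWords N n (desR s r) p
  rises≡descents = begin
    + countWords N n (risR s (t + 1 ∸ r)) p
      ≡⟨ countWords-∑ N n (risR s (t + 1 ∸ r)) p ⟩
    ∑[ π ← words N n ] δ (risR s (t + 1 ∸ r) π) p
      ≡⟨ Complement.rises≡descents s k t t<s 1≤r r≤t n p ⟩
    ∑[ π ← words N n ] δ (desR s r π) p
      ≡⟨ sym (countWords-∑ N n (desR s r) p) ⟩
    + countWords N n (desR s r) p ∎
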